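{- For a positive integer $n$, let $F(n)$ be the number of triangle quadruples $Q=(a,b,c,d)$ with height $H(Q)=\sqrt{a^2+b^2+c^2+d^2}\le n$. Then $F(n)=O(n^2\log^3 n)$.
   Context: A triangle quadruple is a quadruple $(a,b,c,d)$ of nonnegative integers satisfying $3(a^2+b^2+c^2+d^2)=(a+b+c+d)^2$. -}

module Defs where

open import Data.Nat using (ℕ; suc; _+_; _*_; _^_; _≤_; _≟_; _≤?_)
open import Data.List using (List; length; filter; upTo; concatMap; [_])
open import Data.Product using (_×_; _,_)
open import Relation.Binary.PropositionalEquality using (_≡_)
open import Relation.Nullary.Decidable using (Dec; _×-dec_)

Quad : Set
Quad = ℕ × ℕ × ℕ × ℕ

sumSq : Quad → ℕ
sumSq (a , b , c , d) = a ^ 2 + b ^ 2 + c ^ 2 + d ^ 2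

IsTriangleQuadruple : Quad → Set
IsTriangleQuadruple q@(a , b , c , d) = 3 * sumSq q ≡ (a + b + c + d) ^ 2

quadsUpTo : ℕ → List Quad
quadsUpTo n =
  concatMap (λ a → concatMap (λ b → concatMap (λ c → concatMap (λ d →
    [ (a , b , c , d) ]) (upTo (suc n))) (upTo (suc n))) (upTo (suc n))) (upTo (suc n))

-- H(Q) = sqrt(a²+b²+c²+d²) ≤ n  ⇔  a²+b²+c²+d² ≤ n²
-- (such Q automatically have every entry ≤ n, so quadsUpTo n covers them)
isTriangleQuadruple? : (q : Quad) → Dec (IsTriangleQuadruple q)
isTriangleQuadruple? (a , b , c , d) = 3 * sumSq (a , b , c , d) ≟ (a + b + c + d) ^ 2

F : ℕ → ℕ
F n = length (filter (λ q → isTriangleQuadruple? q ×-dec (sumSq q ≤? n ^ 2)) (quadsUpTo n))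

-- For a triangle quadruple (a, b, c, d) one has the identity
--   4 d (a + b + c − d) = (2a − b − c)² + 3 (b − c)²,
-- and d, a + b + c − d, 2a − b − c and b − c determine the quadruple. So F(n) is at most the number of
-- solutions of 4 d u = X² + 3 Y² with d, u, |X|, |Y| = O(n). Grouping by the common value, this is at most
-- the number of solutions of d u = d' u' plus that of X² + 3 Y² = X'² + 3 Y'², and the latter factors as
-- (x − x')(x + x') = 3 (y' − y)(y' + y). Both are thus bounded by the multiplicative energy
-- #{a b = c e : a, b, c, e ≤ K} with K = O(n), which is O(K² log K): writing g = gcd(a, c), a = α g, c = γ g,
-- b = h γ, e = h α, for the larger of α, γ fixed there are at most α choices of the other and K / α of each
-- of g and h, and ∑_α K² / α = O(K² log K). This even gives F(n) = O(n² log n).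

module Submission where

open import Data.Nat
  using (ℕ; zero; suc; _+_; _*_; _^_; _∸_; _≤_; _<_; z≤n; s≤s; s≤s⁻¹; _≟_; _≤?_; _⊔_; NonZero; >-nonZero; ≢-nonZero; >-nonZero⁻¹; pred; _/_; ⌊_/2⌋; ⌈_/2⌉)
open import Data.Nat.Properties
open import Data.Nat.DivMod using (m/n*n≤m; m/n*n≡m; m*n/n≡m; /-monoˡ-≤; /-monoʳ-≤; n/1≡n)
open import Data.Nat.Divisibility using (_∣_; divides; 0∣⇒≡0)
open import Data.Nat.GCD using (gcd; gcd[m,n]∣m; gcd[m,n]∣n; gcd[m,n]≢0)
open import Data.Nat.Coprimality using (Coprime; coprime-/gcd; coprime-divisor) renaming (sym to coprime-sym)
open import Data.Nat.Induction using (<-rec)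
open import Data.Nat.Logarithm using (⌊log₂_⌋; ⌊log₂⌋-mono-≤; ⌊log₂⌊n/2⌋⌋≡⌊log₂n⌋∸1; ⌊log₂[2*b]⌋≡1+⌊log₂b⌋)
open import Data.Nat.Tactic.RingSolver using (solve-∀)
open import Data.List using (List; []; _∷_; _++_; map; concatMap; filter; length; upTo; applyUpTo; cartesianProduct; deduplicate; [_])
open import Data.List.Properties using (applyUpTo-∷ʳ; length-upTo; map-upTo)
open import Data.List.Membership.Propositional using (_∈_)
open import Data.List.Membership.Propositional.Properties
  using (∈-deduplicate⁺; ∈-++⁺ˡ; ∈-++⁺ʳ; ∈-map⁺; ∈-cartesianProduct⁺; ∈-cartesianProduct⁻; ∈-upTo⁺; ∈-upTo⁻)
open import Data.List.Relation.Unary.Any using (here; there)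
open import Data.List.Relation.Unary.All using (lookup)
open import Data.List.Relation.Unary.AllPairs using (_∷_)
open import Data.List.Relation.Unary.Unique.Propositional using (Unique)
open import Data.List.Relation.Unary.Unique.Propositional.Properties using (upTo⁺; cartesianProduct⁺)
open import Data.List.Relation.Unary.Unique.DecPropositional.Properties using (deduplicate-!)
open import Data.Product using (∃₂; _×_; _,_; proj₁; proj₂)
open import Data.Product.Properties using (≡-dec)
open import Data.Integer.Base using (ℤ; -[1+_]; ∣_∣; _⊖_)
open import Data.Integer.Properties using () renaming (_≟_ to _≟ℤ_)
open import Agda.Builtin.Int using (pos)
open import Data.Sum using (inj₁; inj₂)
open import Data.Empty using (⊥-elim)
open import Data.Unit using (⊤; tt)
open import Function using (_∘_)
open import Relation.Nullary using (Dec; yes; no)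
open import Relation.Nullary.Decidable using (_×-dec_)
open import Relation.Unary using (Decidable)
open import Relation.Binary.Definitions using (DecidableEquality)
open import Relation.Binary.PropositionalEquality hiding ([_])

open import Defs

-- Indicators and finite sums

𝟙 : {P : Set} → Dec P → ℕ
𝟙 (yes _) = 1
𝟙 (no _)  = 0

𝟙-yes : {P : Set} (P? : Dec P) → P → 𝟙 P? ≡ 1
𝟙-yes (yes _) _ = refl
𝟙-yes (no ¬p) p = ⊥-elim (¬p p)

𝟙≤ : {P : Set} (P? : Dec P) {n : ℕ} → (P → 1 ≤ n) → 𝟙 P? ≤ n
𝟙≤ (yes p) 1≤n = 1≤n p
𝟙≤ (no _)  _   = z≤n

𝟙-mono : {P Q : Set} (P? : Dec P) (Q? : Dec Q) → (P → Q) → 𝟙 P? ≤ 𝟙 Q?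
𝟙-mono P? Q? P⇒Q = 𝟙≤ P? (λ p → ≤-reflexive (sym (𝟙-yes Q? (P⇒Q p))))

𝟙-≟-sym : {A : Set} (_≟A_ : DecidableEquality A) (x y : A) → 𝟙 (x ≟A y) ≡ 𝟙 (y ≟A x)
𝟙-≟-sym _≟A_ x y = ≤-antisym (𝟙-mono (x ≟A y) (y ≟A x) sym) (𝟙-mono (y ≟A x) (x ≟A y) sym)

𝟙-yes³ : {P Q R : Set} (P? : Dec P) (Q? : Dec Q) (R? : Dec R) → P → Q → R → 𝟙 P? * (𝟙 Q? * 𝟙 R?) ≡ 1
𝟙-yes³ P? Q? R? p q r rewrite 𝟙-yes P? p | 𝟙-yes Q? q | 𝟙-yes R? r = refl

∑ : {A : Set} → List A → (A → ℕ) → ℕ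
∑ []       f = 0
∑ (x ∷ xs) f = f x + ∑ xs f

module _ {A : Set} where

  ∑-cong-∈ : (xs : List A) {f g : A → ℕ} → (∀ {x} → x ∈ xs → f x ≡ g x) → ∑ xs f ≡ ∑ xs g
  ∑-cong-∈ []       f≡g = refl
  ∑-cong-∈ (x ∷ xs) f≡g = cong₂ _+_ (f≡g (here refl)) (∑-cong-∈ xs (f≡g ∘ there))

  ∑-cong : (xs : List A) {f g : A → ℕ} → (∀ x → f x ≡ g x) → ∑ xs f ≡ ∑ xs g
  ∑-cong xs f≡g = ∑-cong-∈ xs (λ {x} _ → f≡g x)

  ∑-mono-∈ : (xs : List A) {f g : A → ℕ} → (∀ {x} → x ∈ xs → f x ≤ g x) → ∑ xs f ≤ ∑ xs g
  ∑-mono-∈ []       f≤g = z≤n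
  ∑-mono-∈ (x ∷ xs) f≤g = +-mono-≤ (f≤g (here refl)) (∑-mono-∈ xs (f≤g ∘ there))

  ∑-mono : (xs : List A) {f g : A → ℕ} → (∀ x → f x ≤ g x) → ∑ xs f ≤ ∑ xs g
  ∑-mono xs f≤g = ∑-mono-∈ xs (λ {x} _ → f≤g x)

  ∑-zero : (xs : List A) → ∑ xs (λ _ → 0) ≡ 0
  ∑-zero []       = refl
  ∑-zero (x ∷ xs) = ∑-zero xs

  ∑-+ : (xs : List A) (f g : A → ℕ) → ∑ xs (λ x → f x + g x) ≡ ∑ xs f + ∑ xs g
  ∑-+ []       f g = refl
  ∑-+ (x ∷ xs) f g rewrite ∑-+ xs f g = +-+-interchange (f x) (g x) (∑ xs f) (∑ xs g)
    where
    +-+-interchange : ∀ a b c d → (a + b) + (c + d) ≡ (a + c) + (b + d)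
    +-+-interchange = solve-∀

  ∑-*ˡ : (xs : List A) (c : ℕ) (f : A → ℕ) → ∑ xs (λ x → c * f x) ≡ c * ∑ xs f
  ∑-*ˡ []       c f = sym (*-zeroʳ c)
  ∑-*ˡ (x ∷ xs) c f rewrite ∑-*ˡ xs c f = sym (*-distribˡ-+ c (f x) (∑ xs f))

  ∑-*ʳ : (xs : List A) (c : ℕ) (f : A → ℕ) → ∑ xs (λ x → f x * c) ≡ ∑ xs f * c
  ∑-*ʳ []       c f = refl
  ∑-*ʳ (x ∷ xs) c f rewrite ∑-*ʳ xs c f = sym (*-distribʳ-+ c (f x) (∑ xs f))

  ∑-++ : (xs ys : List A) (f : A → ℕ) → ∑ (xs ++ ys) f ≡ ∑ xs f + ∑ ys f
  ∑-++ []       ys f = refl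
  ∑-++ (x ∷ xs) ys f rewrite ∑-++ xs ys f = sym (+-assoc (f x) (∑ xs f) (∑ ys f))

  ∑-const : (xs : List A) (c : ℕ) → ∑ xs (λ _ → c) ≡ length xs * c
  ∑-const []       c = refl
  ∑-const (x ∷ xs) c = cong (c +_) (∑-const xs c)

  length-filter : {P : A → Set} (P? : Decidable P) (xs : List A) → length (filter P? xs) ≡ ∑ xs (𝟙 ∘ P?)
  length-filter P? []       = refl
  length-filter P? (x ∷ xs) with P? x
  ... | yes _ = cong suc (length-filter P? xs)
  ... | no _  = length-filter P? xs

∑-map : {A B : Set} (g : A → B) (xs : List A) (f : B → ℕ) → ∑ (map g xs) f ≡ ∑ xs (f ∘ g)
∑-map g []       f = refl
∑-map g (x ∷ xs) f = cong (f (g x) +_) (∑-map g xs f)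

module _ {A B : Set} where

  ∑-swap : (xs : List A) (ys : List B) (f : A → B → ℕ) →
           ∑ xs (λ x → ∑ ys (f x)) ≡ ∑ ys (λ y → ∑ xs (λ x → f x y))
  ∑-swap []       ys f = sym (∑-zero ys)
  ∑-swap (x ∷ xs) ys f rewrite ∑-swap xs ys f = sym (∑-+ ys (f x) (λ y → ∑ xs (λ x → f x y)))

  ∑-cartesianProduct : (xs : List A) (ys : List B) (f : A × B → ℕ) →
                       ∑ (cartesianProduct xs ys) f ≡ ∑ xs (λ x → ∑ ys (λ y → f (x , y)))
  ∑-cartesianProduct []       ys f = refl
  ∑-cartesianProduct (x ∷ xs) ys f =
    trans (∑-++ (map (x ,_) ys) (cartesianProduct xs ys) f)
          (cong₂ _+_ (∑-map (x ,_) ys f) (∑-cartesianProduct xs ys f))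

  ∑-concatMap : (g : A → List B) (xs : List A) (f : B → ℕ) → ∑ (concatMap g xs) f ≡ ∑ xs (λ x → ∑ (g x) f)
  ∑-concatMap g []       f = refl
  ∑-concatMap g (x ∷ xs) f = trans (∑-++ (g x) (concatMap g xs) f) (cong (∑ (g x) f +_) (∑-concatMap g xs f))

∑-product : {A B : Set} (xs : List A) (ys : List B) (f : A → ℕ) (g : B → ℕ) →
            ∑ xs (λ x → ∑ ys (λ y → f x * g y)) ≡ ∑ xs f * ∑ ys g
∑-product xs ys f g = trans (∑-cong xs (λ x → ∑-*ˡ ys (f x) g)) (∑-*ʳ xs (∑ ys g) f)

∑-applyUpTo-∷ʳ : {A : Set} (f : ℕ → A) (N : ℕ) (h : A → ℕ) →
                 ∑ (applyUpTo f (suc N)) h ≡ ∑ (applyUpTo f N) h + h (f N)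
∑-applyUpTo-∷ʳ f N h = begin
    ∑ (applyUpTo f (suc N)) h           ≡⟨ cong (λ xs → ∑ xs h) (sym (applyUpTo-∷ʳ f N)) ⟩
    ∑ (applyUpTo f N ++ [ f N ]) h      ≡⟨ ∑-++ (applyUpTo f N) [ f N ] h ⟩
    ∑ (applyUpTo f N) h + (h (f N) + 0) ≡⟨ cong (∑ (applyUpTo f N) h +_) (+-identityʳ (h (f N))) ⟩
    ∑ (applyUpTo f N) h + h (f N)       ∎
  where open ≡-Reasoning

-- Counting by injections and by common values

module _ {A B : Set} (_≟B_ : DecidableEquality B) where

  private
    δ : B → B → ℕ
    δ v w = 𝟙 (v ≟B w)

    fibre-hit : {Q : B → Set} (Q? : Decidable Q) (J : List B) {v : B} → v ∈ J → Q v →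
                1 ≤ ∑ J (λ j → 𝟙 (Q? j) * δ v j)
    fibre-hit Q? (j ∷ J) {v} (here refl) qv rewrite 𝟙-yes (Q? v) qv | 𝟙-yes (v ≟B v) refl = s≤s z≤n
    fibre-hit Q? (j ∷ J) (there v∈J) qv = ≤-trans (fibre-hit Q? J v∈J qv) (m≤n+m _ _)

    fibre-≤1 : {P : A → Set} (P? : Decidable P) (φ : A → B) (j : B) (I : List A) → Unique I →
               (∀ {i i'} → i ∈ I → i' ∈ I → P i → P i' → φ i ≡ φ i' → i ≡ i') →
               ∑ I (λ i → 𝟙 (P? i) * δ (φ i) j) ≤ 1
    fibre-≤1 P? φ j []       _            inj = z≤n
    fibre-≤1 P? φ j (x ∷ xs) (x∉xs ∷ uxs) inj with P? x | φ x ≟B j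
    ... | yes px | yes φx≡j = ≤-reflexive (cong suc (n≤0⇒n≡0 (≤-trans (∑-mono-∈ xs none) (≤-reflexive (∑-zero xs)))))
      where
      none : ∀ {i} → i ∈ xs → 𝟙 (P? i) * δ (φ i) j ≤ 0
      none {i} i∈xs with P? i | φ i ≟B j
      ... | yes pi | yes φi≡j = ⊥-elim (lookup x∉xs i∈xs (inj (here refl) (there i∈xs) px pi (trans φx≡j (sym φi≡j))))
      ... | yes _  | no _     = z≤n
      ... | no _   | _        = z≤n
    ... | yes _ | no _ = fibre-≤1 P? φ j xs uxs (λ i∈ i'∈ → inj (there i∈) (there i'∈))
    ... | no _  | _    = fibre-≤1 P? φ j xs uxs (λ i∈ i'∈ → inj (there i∈) (there i'∈))

  ∑𝟙-≤-injection : {P : A → Set} {Q : B → Set} (P? : Decidable P) (Q? : Decidable Q) (φ : A → B)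
                   (I : List A) (J : List B) → Unique I →
                   (∀ {i} → i ∈ I → P i → φ i ∈ J × Q (φ i)) →
                   (∀ {i i'} → i ∈ I → i' ∈ I → P i → P i' → φ i ≡ φ i' → i ≡ i') →
                   ∑ I (𝟙 ∘ P?) ≤ ∑ J (𝟙 ∘ Q?)
  ∑𝟙-≤-injection P? Q? φ I J uI into inj = begin
      ∑ I (𝟙 ∘ P?)
    ≤⟨ ∑-mono-∈ I hit ⟩
      ∑ I (λ i → ∑ J (λ j → 𝟙 (Q? j) * (𝟙 (P? i) * δ (φ i) j)))
    ≡⟨ ∑-swap I J _ ⟩
      ∑ J (λ j → ∑ I (λ i → 𝟙 (Q? j) * (𝟙 (P? i) * δ (φ i) j)))
    ≡⟨ ∑-cong J (λ j → ∑-*ˡ I (𝟙 (Q? j)) _) ⟩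
      ∑ J (λ j → 𝟙 (Q? j) * ∑ I (λ i → 𝟙 (P? i) * δ (φ i) j))
    ≤⟨ ∑-mono J (λ j → *-monoʳ-≤ (𝟙 (Q? j)) (fibre-≤1 P? φ j I uI inj)) ⟩
      ∑ J (λ j → 𝟙 (Q? j) * 1)
    ≡⟨ ∑-cong J (λ j → *-identityʳ _) ⟩
      ∑ J (𝟙 ∘ Q?)
    ∎
    where
    open ≤-Reasoning
    hit : ∀ {i} → i ∈ I → 𝟙 (P? i) ≤ ∑ J (λ j → 𝟙 (Q? j) * (𝟙 (P? i) * δ (φ i) j))
    hit {i} i∈I with P? i
    ... | no _   = z≤n
    ... | yes pi = ≤-trans (fibre-hit Q? J (proj₁ (into i∈I pi)) (proj₂ (into i∈I pi)))
                           (≤-reflexive (∑-cong J (λ j → cong (𝟙 (Q? j) *_) (sym (+-identityʳ (δ (φ i) j))))))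

m*n≤m*m+n*n : ∀ m n → m * n ≤ m * m + n * n
m*n≤m*m+n*n m n with ≤-total m n
... | inj₁ m≤n = ≤-trans (*-monoˡ-≤ n m≤n) (m≤n+m _ _)
... | inj₂ n≤m = ≤-trans (*-monoʳ-≤ m n≤m) (m≤m+n _ _)

module _ {C : Set} (_≟C_ : DecidableEquality C) where

  matches : {A B : Set} → List A → (A → C) → List B → (B → C) → ℕ
  matches P f Q g = ∑ P (λ p → ∑ Q (λ q → 𝟙 (f p ≟C g q)))

  private
    ∑-select : (M : List C) → Unique M → {v : C} → v ∈ M → (h : C → ℕ) →
               ∑ M (λ m → 𝟙 (v ≟C m) * h m) ≡ h v
    ∑-select (m ∷ M) (m∉M ∷ uM) {v} (here refl) h rewrite 𝟙-yes (v ≟C v) refl =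
      trans (cong (h v + 0 +_) (n≤0⇒n≡0 (≤-trans (∑-mono-∈ M others) (≤-reflexive (∑-zero M)))))
            (trans (+-identityʳ _) (+-identityʳ _))
      where
      others : ∀ {m'} → m' ∈ M → 𝟙 (v ≟C m') * h m' ≤ 0
      others {m'} m'∈M with v ≟C m'
      ... | yes v≡m' = ⊥-elim (lookup m∉M m'∈M v≡m')
      ... | no _     = z≤n
    ∑-select (m ∷ M) (m∉M ∷ uM) {v} (there v∈M) h with v ≟C m
    ... | yes refl = ⊥-elim (lookup m∉M v∈M refl)
    ... | no _     = ∑-select M uM v∈M h

    ∑-by-value : {X : Set} (xs : List X) (k : X → C) (M : List C) → Unique M → (∀ {x} → x ∈ xs → k x ∈ M) →
                 (h : C → ℕ) → ∑ M (λ m → ∑ xs (λ x → 𝟙 (k x ≟C m)) * h m) ≡ ∑ xs (h ∘ k)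
    ∑-by-value xs k M uM k∈M h = begin
        ∑ M (λ m → ∑ xs (λ x → 𝟙 (k x ≟C m)) * h m)
      ≡⟨ ∑-cong M (λ m → sym (∑-*ʳ xs (h m) _)) ⟩
        ∑ M (λ m → ∑ xs (λ x → 𝟙 (k x ≟C m) * h m))
      ≡⟨ ∑-swap M xs _ ⟩
        ∑ xs (λ x → ∑ M (λ m → 𝟙 (k x ≟C m) * h m))
      ≡⟨ ∑-cong-∈ xs (λ x∈xs → ∑-select M uM (k∈M x∈xs) h) ⟩
        ∑ xs (h ∘ k)
      ∎
      where open ≡-Reasoning

  -- Grouped by the common value m, with multiplicities Dₘ in P and Rₘ in Q,
  -- this reads ∑ₘ Dₘ Rₘ ≤ ∑ₘ (Dₘ² + Rₘ²).
  matches-≤ : {A B : Set} (P : List A) (f : A → C) (Q : List B) (g : B → C) →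
              matches P f Q g ≤ matches P f P f + matches Q g Q g
  matches-≤ P f Q g = begin
      ∑ P (R ∘ f)
    ≡⟨ sym (∑-by-value P f M uM f∈M R) ⟩
      ∑ M (λ m → ∑ P (λ p → 𝟙 (f p ≟C m)) * R m)
    ≡⟨ ∑-cong M (λ m → cong (_* R m) (D-sym m)) ⟩
      ∑ M (λ m → D m * R m)
    ≤⟨ ∑-mono M (λ m → m*n≤m*m+n*n (D m) (R m)) ⟩
      ∑ M (λ m → D m * D m + R m * R m)
    ≡⟨ ∑-+ M _ _ ⟩
      ∑ M (λ m → D m * D m) + ∑ M (λ m → R m * R m)
    ≡⟨ cong₂ _+_ (trans (∑-cong M (λ m → cong (_* D m) (sym (D-sym m)))) (∑-by-value P f M uM f∈M D))
                 (trans (∑-cong M (λ m → cong (_* R m) (sym (R-sym m)))) (∑-by-value Q g M uM g∈M R)) ⟩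
      ∑ P (D ∘ f) + ∑ Q (R ∘ g)
    ∎
    where
    open ≤-Reasoning
    M = deduplicate _≟C_ (map f P ++ map g Q)
    uM : Unique M
    uM = deduplicate-! _≟C_ (map f P ++ map g Q)
    f∈M : ∀ {p} → p ∈ P → f p ∈ M
    f∈M p∈P = ∈-deduplicate⁺ _≟C_ (∈-++⁺ˡ (∈-map⁺ f p∈P))
    g∈M : ∀ {q} → q ∈ Q → g q ∈ M
    g∈M q∈Q = ∈-deduplicate⁺ _≟C_ (∈-++⁺ʳ (map f P) (∈-map⁺ g q∈Q))
    D R : C → ℕ
    D m = ∑ P (λ p → 𝟙 (m ≟C f p))
    R m = ∑ Q (λ q → 𝟙 (m ≟C g q))
    D-sym : ∀ m → ∑ P (λ p → 𝟙 (f p ≟C m)) ≡ D m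
    D-sym m = ∑-cong P (λ p → 𝟙-≟-sym _≟C_ (f p) m)
    R-sym : ∀ m → ∑ Q (λ q → 𝟙 (g q ≟C m)) ≡ R m
    R-sym m = ∑-cong Q (λ q → 𝟙-≟-sym _≟C_ (g q) m)

range : ℕ → List ℕ
range K = upTo (suc K)

∈-range⁺ : ∀ {x K} → x ≤ K → x ∈ range K
∈-range⁺ x≤K = ∈-upTo⁺ (s≤s x≤K)

∈-range⁻ : ∀ {x K} → x ∈ range K → x ≤ K
∈-range⁻ x∈range = s≤s⁻¹ (∈-upTo⁻ x∈range)

square : ℕ → List (ℕ × ℕ)
square K = cartesianProduct (range K) (range K)

cube : ℕ → List Quad
cube K = cartesianProduct (range K) (cartesianProduct (range K) (square K))

square-unique : ∀ K → Unique (square K)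
square-unique K = cartesianProduct⁺ (upTo⁺ (suc K)) (upTo⁺ (suc K))

cube-unique : ∀ K → Unique (cube K)
cube-unique K = cartesianProduct⁺ (upTo⁺ (suc K)) (cartesianProduct⁺ (upTo⁺ (suc K)) (square-unique K))

∈-square⁺ : ∀ {x y K} → x ≤ K → y ≤ K → (x , y) ∈ square K
∈-square⁺ x≤K y≤K = ∈-cartesianProduct⁺ (∈-range⁺ x≤K) (∈-range⁺ y≤K)

∈-square⁻ : ∀ {x y K} → (x , y) ∈ square K → x ≤ K × y ≤ K
∈-square⁻ {K = K} xy∈ with ∈-cartesianProduct⁻ (range K) (range K) xy∈
... | x∈ , y∈ = ∈-range⁻ x∈ , ∈-range⁻ y∈

Bounded : ℕ → Quad → Set
Bounded K (a , b , c , d) = a ≤ K × b ≤ K × c ≤ K × d ≤ K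

∈-cube⁺ : ∀ {K q} → Bounded K q → q ∈ cube K
∈-cube⁺ (a≤K , b≤K , c≤K , d≤K) = ∈-cartesianProduct⁺ (∈-range⁺ a≤K) (∈-cartesianProduct⁺ (∈-range⁺ b≤K) (∈-square⁺ c≤K d≤K))

∈-cube⁻ : ∀ {K a b c d} → (a , b , c , d) ∈ cube K → Bounded K (a , b , c , d)
∈-cube⁻ {K} q∈ with ∈-cartesianProduct⁻ (range K) _ q∈
... | a∈ , bcd∈ with ∈-cartesianProduct⁻ (range K) (square K) bcd∈
... | b∈ , cd∈ = ∈-range⁻ a∈ , ∈-range⁻ b∈ , ∈-square⁻ cd∈

∑-square : ∀ K (f : ℕ × ℕ → ℕ) → ∑ (square K) f ≡ ∑ (range K) λ x → ∑ (range K) λ y → f (x , y)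
∑-square K = ∑-cartesianProduct (range K) (range K)

∑-cube : ∀ K (f : Quad → ℕ) →
         ∑ (cube K) f ≡ ∑ (range K) λ a → ∑ (range K) λ b → ∑ (range K) λ c → ∑ (range K) λ d → f (a , b , c , d)
∑-cube K f =
  trans (∑-cartesianProduct (range K) (cartesianProduct (range K) (square K)) f) (∑-cong (range K) λ a →
  trans (∑-cartesianProduct (range K) (square K) (λ bcd → f (a , bcd))) (∑-cong (range K) λ b →
  ∑-square K (λ cd → f (a , b , cd))))

∑-quadsUpTo : ∀ n (f : Quad → ℕ) → ∑ (quadsUpTo n) f ≡ ∑ (cube n) f
∑-quadsUpTo n f = trans nested (sym (∑-cube n f))
  where
  R = range n
  nested : ∑ (quadsUpTo n) f ≡ ∑ R λ a → ∑ R λ b → ∑ R λ c → ∑ R λ d → f (a , b , c , d)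
  nested =
    trans (∑-concatMap (λ a → concatMap (λ b → concatMap (λ c → concatMap (λ d → [ (a , b , c , d) ]) R) R) R) R f)
    (∑-cong R λ a → trans (∑-concatMap (λ b → concatMap (λ c → concatMap (λ d → [ (a , b , c , d) ]) R) R) R f)
    (∑-cong R λ b → trans (∑-concatMap (λ c → concatMap (λ d → [ (a , b , c , d) ]) R) R f)
    (∑-cong R λ c → trans (∑-concatMap (λ d → [ (a , b , c , d) ]) R f)
    (∑-cong R λ d → +-identityʳ _))))

_≟Q_ : DecidableEquality Quad
_≟Q_ = ≡-dec _≟_ (≡-dec _≟_ (≡-dec _≟_ _≟_))

count-range-≤ : {P : ℕ → Set} (P? : Decidable P) (K t : ℕ) → (∀ x → P x → 1 ≤ x × x ≤ t) → ∑ (range K) (𝟙 ∘ P?) ≤ t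
count-range-≤ {P} P? K t bounds = begin
    ∑ (range K) (𝟙 ∘ P?)
  ≤⟨ ∑𝟙-≤-injection _≟_ P? (λ _ → yes tt) pred (range K) (upTo t) (upTo⁺ (suc K)) into inj ⟩
    ∑ (upTo t) (λ _ → 1)
  ≡⟨ ∑-const (upTo t) 1 ⟩
    length (upTo t) * 1
  ≡⟨ trans (*-identityʳ _) (length-upTo t) ⟩
    t
  ∎
  where
  open ≤-Reasoning
  into : ∀ {x} → x ∈ range K → P x → pred x ∈ upTo t × ⊤
  into {x} _ px with bounds x px
  ... | s≤s z≤n , x≤t = ∈-upTo⁺ x≤t , tt
  inj : ∀ {x y} → x ∈ range K → y ∈ range K → P x → P y → pred x ≡ pred y → x ≡ y
  inj {x} {y} _ _ px py px≡py with bounds x px | bounds y py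
  ... | s≤s z≤n , _ | s≤s z≤n , _ = cong suc px≡py

∑-range-1 : ∀ K → ∑ (range K) (λ _ → 1) ≡ suc K
∑-range-1 K = trans (∑-const (range K) 1) (trans (*-identityʳ _) (length-upTo (suc K)))

∑-range-𝟙≟0 : ∀ K → ∑ (range K) (λ x → 𝟙 (x ≟ 0)) ≡ 1
∑-range-𝟙≟0 K =
  cong suc (trans (cong (λ xs → ∑ xs (λ x → 𝟙 (x ≟ 0))) (sym (map-upTo suc K)))
                  (trans (∑-map suc (upTo K) _) (∑-zero (upTo K))))

-- Total division and harmonic sums

-- A total division (m ÷ 0 = 0), so that quotients by gcd a c and the sum of K ÷ α over α ∈ [0, K]
-- need no side conditions.
_÷_ : ℕ → ℕ → ℕ
m ÷ zero  = 0
m ÷ suc n = m / suc n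

m÷n≡m/n : ∀ m n .{{_ : NonZero n}} → m ÷ n ≡ m / n
m÷n≡m/n m (suc n) = refl

m÷n*n≡m : ∀ {m n} → n ∣ m → (m ÷ n) * n ≡ m
m÷n*n≡m {m} {zero}  0∣m = sym (0∣⇒≡0 0∣m)
m÷n*n≡m {m} {suc n} n∣m = m/n*n≡m n∣m

harmonic : ℕ → ℕ → ℕ
harmonic K zero    = 0
harmonic K (suc N) = harmonic K N + K / suc N

∑-range-÷ : ∀ K → ∑ (range K) (K ÷_) ≡ harmonic K K
∑-range-÷ K = ∑-from-1 K
  where
  ∑-from-1 : ∀ N → ∑ (applyUpTo suc N) (K ÷_) ≡ harmonic K N
  ∑-from-1 zero    = refl
  ∑-from-1 (suc N) = trans (∑-applyUpTo-∷ʳ suc N (K ÷_)) (cong (_+ K / suc N) (∑-from-1 N))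

harmonic-+ : ∀ K M t → harmonic K (t + M) ≤ harmonic K M + t * (K / suc M)
harmonic-+ K M zero    = ≤-reflexive (sym (+-identityʳ _))
harmonic-+ K M (suc t) = begin
    harmonic K (t + M) + K / suc (t + M)
  ≤⟨ +-mono-≤ (harmonic-+ K M t) (/-monoʳ-≤ K (s≤s (m≤n+m M t))) ⟩
    harmonic K M + t * (K / suc M) + K / suc M
  ≡⟨ +-assoc (harmonic K M) _ _ ⟩
    harmonic K M + (t * (K / suc M) + K / suc M)
  ≡⟨ cong (harmonic K M +_) (+-comm (t * (K / suc M)) _) ⟩
    harmonic K M + suc t * (K / suc M)
  ∎
  where open ≤-Reasoning

⌈n/2⌉≤1+⌊n/2⌋ : ∀ n → ⌈ n /2⌉ ≤ suc ⌊ n /2⌋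
⌈n/2⌉≤1+⌊n/2⌋ zero          = z≤n
⌈n/2⌉≤1+⌊n/2⌋ (suc zero)    = s≤s z≤n
⌈n/2⌉≤1+⌊n/2⌋ (suc (suc n)) = s≤s (⌈n/2⌉≤1+⌊n/2⌋ n)

2≤n⇒1≤⌊log₂n⌋ : ∀ {n} → 2 ≤ n → 1 ≤ ⌊log₂ n ⌋
2≤n⇒1≤⌊log₂n⌋ 2≤n = ⌊log₂⌋-mono-≤ {2} 2≤n

-- The terms with ⌊N/2⌋ < a ≤ N number ⌈N/2⌉ ≤ ⌊N/2⌋ + 1 and are each at most K / (⌊N/2⌋ + 1),
-- so each halving of N costs at most K.
harmonic-≤ : ∀ K N → harmonic K N ≤ K * (⌊log₂ N ⌋ + 1)
harmonic-≤ K = <-rec _ bound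
  where
  bound : ∀ N → (∀ {M} → M < N → harmonic K M ≤ K * (⌊log₂ M ⌋ + 1)) → harmonic K N ≤ K * (⌊log₂ N ⌋ + 1)
  bound zero          _   = z≤n
  bound (suc zero)    _   = ≤-reflexive (trans (n/1≡n K) (sym (*-identityʳ K)))
  bound N@(suc (suc N')) rec = begin
      harmonic K N
    ≡⟨ cong (harmonic K) (trans (sym (⌊n/2⌋+⌈n/2⌉≡n N)) (+-comm M ⌈ N /2⌉)) ⟩
      harmonic K (⌈ N /2⌉ + M)
    ≤⟨ harmonic-+ K M ⌈ N /2⌉ ⟩
      harmonic K M + ⌈ N /2⌉ * (K / suc M)
    ≤⟨ +-mono-≤ (rec (⌊n/2⌋<n (suc N'))) tail≤K ⟩
      K * (⌊log₂ M ⌋ + 1) + K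
    ≡⟨ cong (λ l → K * l + K) (trans (cong (_+ 1) (⌊log₂⌊n/2⌋⌋≡⌊log₂n⌋∸1 N)) (m∸n+n≡m (2≤n⇒1≤⌊log₂n⌋ {N} (s≤s (s≤s z≤n))))) ⟩
      K * ⌊log₂ N ⌋ + K
    ≡⟨ sym (*-suc-comm K ⌊log₂ N ⌋) ⟩
      K * (⌊log₂ N ⌋ + 1)
    ∎
    where
    open ≤-Reasoning
    M = ⌊ N /2⌋
    *-suc-comm : ∀ k l → k * (l + 1) ≡ k * l + k
    *-suc-comm = solve-∀
    tail≤K : ⌈ N /2⌉ * (K / suc M) ≤ K
    tail≤K = ≤-trans (*-monoˡ-≤ (K / suc M) (⌈n/2⌉≤1+⌊n/2⌋ N)) (≤-trans (≤-reflexive (*-comm (suc M) (K / suc M))) (m/n*n≤m K (suc M)))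

⌊log₂8n⌋≡3+⌊log₂n⌋ : ∀ n .{{_ : NonZero n}} → ⌊log₂ (8 * n) ⌋ ≡ 3 + ⌊log₂ n ⌋
⌊log₂8n⌋≡3+⌊log₂n⌋ n@(suc _) = begin
    ⌊log₂ (8 * n) ⌋                 ≡⟨ cong ⌊log₂_⌋ (8n≡2[2[2n]] n) ⟩
    ⌊log₂ (2 * (2 * (2 * n))) ⌋     ≡⟨ ⌊log₂[2*b]⌋≡1+⌊log₂b⌋ (2 * (2 * n)) ⟩
    1 + ⌊log₂ (2 * (2 * n)) ⌋       ≡⟨ cong suc (⌊log₂[2*b]⌋≡1+⌊log₂b⌋ (2 * n)) ⟩
    2 + ⌊log₂ (2 * n) ⌋             ≡⟨ cong (λ l → 2 + l) (⌊log₂[2*b]⌋≡1+⌊log₂b⌋ n) ⟩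
    3 + ⌊log₂ n ⌋                   ∎
  where
  open ≡-Reasoning
  8n≡2[2[2n]] : ∀ n → 8 * n ≡ 2 * (2 * (2 * n))
  8n≡2[2[2n]] = solve-∀

⌊log₂6n⌋+1≤5⌊log₂n⌋ : ∀ {n} → 2 ≤ n → ⌊log₂ (6 * n) ⌋ + 1 ≤ 5 * ⌊log₂ n ⌋
⌊log₂6n⌋+1≤5⌊log₂n⌋ {n@(suc _)} 2≤n = begin
    ⌊log₂ (6 * n) ⌋ + 1   ≤⟨ +-monoˡ-≤ 1 (⌊log₂⌋-mono-≤ (*-monoˡ-≤ n {6} {8} (m≤m+n 6 2))) ⟩
    ⌊log₂ (8 * n) ⌋ + 1   ≡⟨ cong (_+ 1) (⌊log₂8n⌋≡3+⌊log₂n⌋ n) ⟩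
    3 + L + 1             ≡⟨ shift L ⟩
    L + 4 * 1             ≤⟨ +-monoʳ-≤ L (*-monoʳ-≤ 4 (2≤n⇒1≤⌊log₂n⌋ 2≤n)) ⟩
    L + 4 * L             ≡⟨ five L ⟩
    5 * L                 ∎
  where
  open ≤-Reasoning
  L = ⌊log₂ n ⌋
  shift : ∀ l → 3 + l + 1 ≡ l + 4 * 1
  shift = solve-∀
  five : ∀ l → l + 4 * l ≡ 5 * l
  five = solve-∀

-- Multiplicative energy

1≤m*n⇒1≤m : ∀ m n → 1 ≤ m * n → 1 ≤ m
1≤m*n⇒1≤m (suc m) n _ = s≤s z≤n

1≤m*n⇒1≤n : ∀ m n → 1 ≤ m * n → 1 ≤ n
1≤m*n⇒1≤n m n 1≤mn = 1≤m*n⇒1≤m n m (subst (1 ≤_) (*-comm m n) 1≤mn)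

gcd-decomposition : ∀ a c → 1 ≤ a →
  1 ≤ gcd a c × (a ÷ gcd a c) * gcd a c ≡ a × (c ÷ gcd a c) * gcd a c ≡ c × Coprime (a ÷ gcd a c) (c ÷ gcd a c)
gcd-decomposition a c (s≤s z≤n) =
  >-nonZero⁻¹ (gcd a c) , m÷n*n≡m (gcd[m,n]∣m a c) , m÷n*n≡m (gcd[m,n]∣n a c) ,
  subst₂ Coprime (sym (m÷n≡m/n a (gcd a c))) (sym (m÷n≡m/n c (gcd a c))) (coprime-/gcd a c)
  where
  instance
    gcd≢0 : NonZero (gcd a c)
    gcd≢0 = ≢-nonZero (gcd[m,n]≢0 a c (inj₁ (λ ())))

≤-by-factor : ∀ {x y z K} → 1 ≤ y → y * x ≡ z → z ≤ K → x ≤ K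
≤-by-factor {x} {y} 1≤y yx≡z z≤K = ≤-trans (m≤n*m x y {{>-nonZero 1≤y}}) (≤-trans (≤-reflexive yx≡z) z≤K)

Positive : Quad → Set
Positive (a , b , c , e) = 1 ≤ a × 1 ≤ b × 1 ≤ c × 1 ≤ e

positive? : Decidable Positive
positive? (a , b , c , e) = 1 ≤? a ×-dec 1 ≤? b ×-dec 1 ≤? c ×-dec 1 ≤? e

IsMulCollision : Quad → Set
IsMulCollision (a , b , c , e) = a * b ≡ c * e

isMulCollision? : Decidable IsMulCollision
isMulCollision? (a , b , c , e) = a * b ≟ c * e

mulEnergy : ℕ → ℕ
mulEnergy K = ∑ (cube K) (𝟙 ∘ isMulCollision?)

IsPositiveCollision : Quad → Set
IsPositiveCollision q = Positive q × IsMulCollision q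

isPositiveCollision? : Decidable IsPositiveCollision
isPositiveCollision? q = positive? q ×-dec isMulCollision? q

toParams : Quad → Quad
toParams (a , b , c , e) = a ÷ gcd a c , c ÷ gcd a c , gcd a c , b ÷ (c ÷ gcd a c)

fromParams : Quad → Quad
fromParams (α , γ , g , h) = α * g , h * γ , γ * g , h * α

coprime-cross : ∀ {α γ b e} → Coprime α γ → 1 ≤ γ → α * b ≡ γ * e → (b ÷ γ) * γ ≡ b × (b ÷ γ) * α ≡ e
coprime-cross {α} {γ} {b} {e} α⊥γ 1≤γ αb≡γe = hγ≡b , hα≡e
  where
  h = b ÷ γ
  hγ≡b : h * γ ≡ b
  hγ≡b = m÷n*n≡m (coprime-divisor (coprime-sym α⊥γ) (divides e (trans αb≡γe (*-comm γ e))))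
  x[hy]≡y[hx] : ∀ x h y → x * (h * y) ≡ y * (h * x)
  x[hy]≡y[hx] = solve-∀
  hα≡e : h * α ≡ e
  hα≡e = *-cancelˡ-≡ (h * α) e γ {{>-nonZero 1≤γ}} (begin
      γ * (h * α)  ≡⟨ x[hy]≡y[hx] γ h α ⟩
      α * (h * γ)  ≡⟨ cong (α *_) hγ≡b ⟩
      α * b        ≡⟨ αb≡γe ⟩
      γ * e        ∎)
    where open ≡-Reasoning

-- With g = gcd a c write a = α g and c = γ g, α and γ coprime; cancelling g gives α b = γ e.
fromParams∘toParams : ∀ {q} → IsPositiveCollision q → fromParams (toParams q) ≡ q × Positive (toParams q)
fromParams∘toParams {a , b , c , e} ((1≤a , 1≤b , 1≤c , 1≤e) , ab≡ce) =
  cong₂ _,_ αg≡a (cong₂ _,_ (proj₁ hγ≡b×hα≡e) (cong₂ _,_ γg≡c (proj₂ hγ≡b×hα≡e))) , 1≤α , 1≤γ , 1≤g , 1≤h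
  where
  g = gcd a c
  α = a ÷ g
  γ = c ÷ g
  decomposition = gcd-decomposition a c 1≤a
  1≤g : 1 ≤ g
  1≤g = proj₁ decomposition
  αg≡a : α * g ≡ a
  αg≡a = proj₁ (proj₂ decomposition)
  γg≡c : γ * g ≡ c
  γg≡c = proj₁ (proj₂ (proj₂ decomposition))
  1≤α : 1 ≤ α
  1≤α = 1≤m*n⇒1≤m α g (subst (1 ≤_) (sym αg≡a) 1≤a)
  1≤γ : 1 ≤ γ
  1≤γ = 1≤m*n⇒1≤m γ g (subst (1 ≤_) (sym γg≡c) 1≤c)
  x[yz]≡[yx]z : ∀ x y z → x * (y * z) ≡ (y * x) * z
  x[yz]≡[yx]z = solve-∀
  αb≡γe : α * b ≡ γ * e
  αb≡γe = *-cancelˡ-≡ (α * b) (γ * e) g {{>-nonZero 1≤g}} (begin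
      g * (α * b)  ≡⟨ x[yz]≡[yx]z g α b ⟩
      (α * g) * b  ≡⟨ cong (_* b) αg≡a ⟩
      a * b        ≡⟨ ab≡ce ⟩
      c * e        ≡⟨ cong (_* e) (sym γg≡c) ⟩
      (γ * g) * e  ≡⟨ sym (x[yz]≡[yx]z g γ e) ⟩
      g * (γ * e)  ∎)
    where open ≡-Reasoning
  hγ≡b×hα≡e = coprime-cross (proj₂ (proj₂ (proj₂ decomposition))) 1≤γ αb≡γe
  1≤h : 1 ≤ b ÷ γ
  1≤h = 1≤m*n⇒1≤m (b ÷ γ) γ (subst (1 ≤_) (sym (proj₁ hγ≡b×hα≡e)) 1≤b)

IsParameter : ℕ → Quad → Set
IsParameter K p = Positive p × Bounded K (fromParams p)

isParameter? : ∀ K → Decidable (IsParameter K)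
isParameter? K p@(α , γ , g , h) = positive? p ×-dec (α * g ≤? K ×-dec h * γ ≤? K ×-dec γ * g ≤? K ×-dec h * α ≤? K)

parameter-bounded : ∀ {K p} → IsParameter K p → Bounded K p
parameter-bounded {K} {α , γ , g , h} ((1≤α , 1≤γ , 1≤g , 1≤h) , (αg≤K , _ , γg≤K , hα≤K)) =
  ≤-by-factor 1≤g (*-comm g α) αg≤K , ≤-by-factor 1≤g (*-comm g γ) γg≤K ,
  ≤-by-factor 1≤γ refl γg≤K , ≤-by-factor 1≤α (*-comm α h) hα≤K

positiveCollisions-≤-parameters : ∀ K → ∑ (cube K) (𝟙 ∘ isPositiveCollision?) ≤ ∑ (cube K) (𝟙 ∘ isParameter? K)
positiveCollisions-≤-parameters K =
  ∑𝟙-≤-injection _≟Q_ isPositiveCollision? (isParameter? K) toParams (cube K) (cube K) (cube-unique K) into inj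
  where
  into : ∀ {q} → q ∈ cube K → IsPositiveCollision q → toParams q ∈ cube K × IsParameter K (toParams q)
  into {a , b , c , e} q∈ coll with fromParams∘toParams coll
  ... | back , positive = ∈-cube⁺ (parameter-bounded parameter) , parameter
    where
    parameter : IsParameter K (toParams (a , b , c , e))
    parameter = positive , subst (Bounded K) (sym back) (∈-cube⁻ q∈)
  inj : ∀ {q q'} → q ∈ cube K → q' ∈ cube K → IsPositiveCollision q → IsPositiveCollision q' →
        toParams q ≡ toParams q' → q ≡ q'
  inj _ _ coll coll' eq =
    trans (sym (proj₁ (fromParams∘toParams coll))) (trans (cong fromParams eq) (proj₁ (fromParams∘toParams coll')))

module ParameterCount (K : ℕ) where

  Fits : ℕ → ℕ → Set
  Fits α x = 1 ≤ x × x * α ≤ K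

  fits? : ∀ α → Decidable (Fits α)
  fits? α x = 1 ≤? x ×-dec x * α ≤? K

  Below : ℕ → ℕ → Set
  Below α γ = 1 ≤ γ × γ ≤ α

  below? : ∀ α → Decidable (Below α)
  below? α γ = 1 ≤? γ ×-dec γ ≤? α

  dominated : ℕ → ℕ → ℕ → ℕ → ℕ
  dominated α γ g h = 𝟙 (below? α γ) * (𝟙 (fits? α g) * 𝟙 (fits? α h))

  parameter-≤-dominated : ∀ α γ g h → 𝟙 (isParameter? K (α , γ , g , h)) ≤ dominated α γ g h + dominated γ α g h
  parameter-≤-dominated α γ g h = 𝟙≤ (isParameter? K (α , γ , g , h)) by-order
    where
    by-order : IsParameter K (α , γ , g , h) → 1 ≤ dominated α γ g h + dominated γ α g h
    by-order ((1≤α , 1≤γ , 1≤g , 1≤h) , (αg≤K , hγ≤K , γg≤K , hα≤K)) with ≤-total γ α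
    ... | inj₁ γ≤α = ≤-trans (≤-reflexive (sym (𝟙-yes³ (below? α γ) (fits? α g) (fits? α h)
                               (1≤γ , γ≤α) (1≤g , subst (_≤ K) (*-comm α g) αg≤K) (1≤h , hα≤K))))
                             (m≤m+n _ _)
    ... | inj₂ α≤γ = ≤-trans (≤-reflexive (sym (𝟙-yes³ (below? γ α) (fits? γ g) (fits? γ h)
                               (1≤α , α≤γ) (1≤g , subst (_≤ K) (*-comm γ g) γg≤K) (1≤h , hγ≤K))))
                             (m≤n+m _ _)

  ∑-dominated-≤ : ∀ α → ∑ (range K) (λ γ → ∑ (range K) λ g → ∑ (range K) λ h → dominated α γ g h) ≤ K * (K ÷ α)
  ∑-dominated-≤ α = begin
      ∑ (range K) (λ γ → ∑ (range K) λ g → ∑ (range K) λ h → dominated α γ g h)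
    ≡⟨ ∑-cong (range K) (λ γ → trans (∑-cong (range K) (λ g → ∑-*ˡ (range K) (𝟙 (below? α γ)) _))
                                     (trans (∑-*ˡ (range K) (𝟙 (below? α γ)) _)
                                            (cong (𝟙 (below? α γ) *_) (∑-product (range K) (range K) (𝟙 ∘ fits? α) (𝟙 ∘ fits? α))))) ⟩
      ∑ (range K) (λ γ → 𝟙 (below? α γ) * (n * n))
    ≡⟨ ∑-*ʳ (range K) (n * n) (𝟙 ∘ below? α) ⟩
      ∑ (range K) (𝟙 ∘ below? α) * (n * n)
    ≤⟨ *-monoˡ-≤ (n * n) (count-range-≤ (below? α) K α (λ _ below → below)) ⟩
      α * (n * n)
    ≤⟨ bound α ⟩
      K * (K ÷ α)
    ∎
    where
    open ≤-Reasoning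
    n = ∑ (range K) (𝟙 ∘ fits? α)
    bound : ∀ α → α * (∑ (range K) (𝟙 ∘ fits? α) * ∑ (range K) (𝟙 ∘ fits? α)) ≤ K * (K ÷ α)
    bound zero = z≤n
    bound α@(suc _) = begin
        α * (m * m)  ≡⟨ sym (*-assoc α m m) ⟩
        α * m * m    ≤⟨ *-mono-≤ (≤-trans (*-monoʳ-≤ α m≤K/α) (≤-trans (≤-reflexive (*-comm α (K / α))) (m/n*n≤m K α))) m≤K/α ⟩
        K * (K / α)  ∎
      where
      m = ∑ (range K) (𝟙 ∘ fits? α)
      m≤K/α : m ≤ K / α
      m≤K/α = count-range-≤ (fits? α) K (K / α)
                (λ x (1≤x , xα≤K) → 1≤x , ≤-trans (≤-reflexive (sym (m*n/n≡m x α))) (/-monoˡ-≤ α xα≤K))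

  parameters-≤ : ∑ (cube K) (𝟙 ∘ isParameter? K) ≤ 2 * (K * (K * (⌊log₂ K ⌋ + 1)))
  parameters-≤ = begin
      ∑ (cube K) (𝟙 ∘ isParameter? K)
    ≤⟨ ∑-mono (cube K) (λ (α , γ , g , h) → parameter-≤-dominated α γ g h) ⟩
      ∑ (cube K) (λ (α , γ , g , h) → dominated α γ g h + dominated γ α g h)
    ≡⟨ ∑-+ (cube K) D (λ (α , γ , g , h) → dominated γ α g h) ⟩
      ∑ (cube K) D + ∑ (cube K) (λ (α , γ , g , h) → dominated γ α g h)
    ≡⟨ cong (∑ (cube K) D +_) (trans (∑-cube K _) (trans (∑-swap (range K) (range K) _) (sym (∑-cube K D)))) ⟩
      ∑ (cube K) D + ∑ (cube K) D
    ≡⟨ cong (∑ (cube K) D +_) (sym (+-identityʳ _)) ⟩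
      2 * ∑ (cube K) D
    ≤⟨ *-monoʳ-≤ 2 (begin
        ∑ (cube K) D
      ≡⟨ ∑-cube K D ⟩
        ∑ (range K) (λ α → ∑ (range K) λ γ → ∑ (range K) λ g → ∑ (range K) λ h → dominated α γ g h)
      ≤⟨ ∑-mono (range K) ∑-dominated-≤ ⟩
        ∑ (range K) (λ α → K * (K ÷ α))
      ≡⟨ ∑-*ˡ (range K) K (K ÷_) ⟩
        K * ∑ (range K) (K ÷_)
      ≤⟨ *-monoʳ-≤ K (≤-trans (≤-reflexive (∑-range-÷ K)) (harmonic-≤ K K)) ⟩
        K * (K * (⌊log₂ K ⌋ + 1))
      ∎) ⟩
      2 * (K * (K * (⌊log₂ K ⌋ + 1)))
    ∎
    where
    open ≤-Reasoning
    D : Quad → ℕ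
    D (α , γ , g , h) = dominated α γ g h

𝟙[m*n≟0]≤ : ∀ m n → 𝟙 (m * n ≟ 0) ≤ 𝟙 (m ≟ 0) + 𝟙 (n ≟ 0)
𝟙[m*n≟0]≤ m n = 𝟙≤ (m * n ≟ 0) one-factor
  where
  one-factor : m * n ≡ 0 → 1 ≤ 𝟙 (m ≟ 0) + 𝟙 (n ≟ 0)
  one-factor mn≡0 with m*n≡0⇒m≡0∨n≡0 m mn≡0
  ... | inj₁ m≡0 = ≤-trans (≤-reflexive (sym (𝟙-yes (m ≟ 0) m≡0))) (m≤m+n _ _)
  ... | inj₂ n≡0 = ≤-trans (≤-reflexive (sym (𝟙-yes (n ≟ 0) n≡0))) (m≤n+m _ _)

zeroProducts : ℕ → ℕ
zeroProducts K = ∑ (range K) λ a → ∑ (range K) λ b → 𝟙 (a * b ≟ 0)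

zeroProducts-≤ : ∀ K → zeroProducts K ≤ 2 * suc K
zeroProducts-≤ K = begin
    zeroProducts K
  ≤⟨ ∑-mono R (λ a → ∑-mono R (λ b → 𝟙[m*n≟0]≤ a b)) ⟩
    ∑ R (λ a → ∑ R λ b → 𝟙 (a ≟ 0) + 𝟙 (b ≟ 0))
  ≡⟨ trans (∑-cong R (λ a → ∑-+ R (λ _ → 𝟙 (a ≟ 0)) (λ b → 𝟙 (b ≟ 0))))
           (∑-+ R (λ a → ∑ R λ _ → 𝟙 (a ≟ 0)) (λ _ → ∑ R λ b → 𝟙 (b ≟ 0))) ⟩
    ∑ R (λ a → ∑ R λ b → 𝟙 (a ≟ 0)) + ∑ R (λ a → ∑ R λ b → 𝟙 (b ≟ 0))
  ≡⟨ cong₂ _+_ (trans (∑-swap R R (λ a _ → 𝟙 (a ≟ 0))) (∑-cong R (λ _ → ∑-range-𝟙≟0 K))) (∑-cong R (λ _ → ∑-range-𝟙≟0 K)) ⟩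
    ∑ R (λ _ → 1) + ∑ R (λ _ → 1)
  ≡⟨ cong₂ _+_ (∑-range-1 K) (trans (∑-range-1 K) (sym (+-identityʳ _))) ⟩
    2 * suc K
  ∎
  where
  open ≤-Reasoning
  R = range K

mulCollision-≤ : ∀ a b c e → let q = (a , b , c , e) in
                 𝟙 (isMulCollision? q) ≤ 𝟙 (a * b ≟ 0) * 𝟙 (c * e ≟ 0) + 𝟙 (isPositiveCollision? q)
mulCollision-≤ a b c e = 𝟙≤ (isMulCollision? q) zero-or-positive
  where
  q = (a , b , c , e)
  zero-or-positive : a * b ≡ c * e → 1 ≤ 𝟙 (a * b ≟ 0) * 𝟙 (c * e ≟ 0) + 𝟙 (isPositiveCollision? q)
  zero-or-positive ab≡ce with a * b ≟ 0
  ... | yes ab≡0 rewrite 𝟙-yes (c * e ≟ 0) (trans (sym ab≡ce) ab≡0) = s≤s z≤n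
  ... | no ab≢0 = ≤-trans (≤-reflexive (sym (𝟙-yes (isPositiveCollision? q) (positive , ab≡ce)))) (m≤n+m _ _)
    where
    1≤ab : 1 ≤ a * b
    1≤ab = n≢0⇒n>0 ab≢0
    1≤ce : 1 ≤ c * e
    1≤ce = subst (1 ≤_) ab≡ce 1≤ab
    positive : Positive q
    positive = 1≤m*n⇒1≤m a b 1≤ab , 1≤m*n⇒1≤n a b 1≤ab , 1≤m*n⇒1≤m c e 1≤ce , 1≤m*n⇒1≤n c e 1≤ce

bothZeroProducts≡ : ∀ K → ∑ (cube K) (λ (a , b , c , e) → 𝟙 (a * b ≟ 0) * 𝟙 (c * e ≟ 0)) ≡ zeroProducts K * zeroProducts K
bothZeroProducts≡ K = begin
    ∑ (cube K) (λ (a , b , c , e) → 𝟙 (a * b ≟ 0) * 𝟙 (c * e ≟ 0))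
  ≡⟨ ∑-cube K (λ (a , b , c , e) → 𝟙 (a * b ≟ 0) * 𝟙 (c * e ≟ 0)) ⟩
    ∑ R (λ a → ∑ R λ b → ∑ R λ c → ∑ R λ e → 𝟙 (a * b ≟ 0) * 𝟙 (c * e ≟ 0))
  ≡⟨ ∑-cong R (λ a → ∑-cong R (λ b →
       trans (∑-cong R (λ c → ∑-*ˡ R (𝟙 (a * b ≟ 0)) (λ e → 𝟙 (c * e ≟ 0))))
             (∑-*ˡ R (𝟙 (a * b ≟ 0)) (λ c → ∑ R λ e → 𝟙 (c * e ≟ 0))))) ⟩
    ∑ R (λ a → ∑ R λ b → 𝟙 (a * b ≟ 0) * Z)
  ≡⟨ trans (∑-cong R (λ a → ∑-*ʳ R Z (λ b → 𝟙 (a * b ≟ 0)))) (∑-*ʳ R Z (λ a → ∑ R λ b → 𝟙 (a * b ≟ 0))) ⟩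
    Z * Z
  ∎
  where
  open ≡-Reasoning
  R = range K
  Z = zeroProducts K

mulEnergy-≤ : ∀ K → mulEnergy K ≤ (2 * suc K) * (2 * suc K) + 2 * (K * (K * (⌊log₂ K ⌋ + 1)))
mulEnergy-≤ K = begin
    mulEnergy K
  ≤⟨ ∑-mono (cube K) (λ (a , b , c , e) → mulCollision-≤ a b c e) ⟩
    ∑ (cube K) (λ (a , b , c , e) → 𝟙 (a * b ≟ 0) * 𝟙 (c * e ≟ 0) + 𝟙 (isPositiveCollision? (a , b , c , e)))
  ≡⟨ ∑-+ (cube K) (λ (a , b , c , e) → 𝟙 (a * b ≟ 0) * 𝟙 (c * e ≟ 0)) (𝟙 ∘ isPositiveCollision?) ⟩
    ∑ (cube K) (λ (a , b , c , e) → 𝟙 (a * b ≟ 0) * 𝟙 (c * e ≟ 0)) + ∑ (cube K) (𝟙 ∘ isPositiveCollision?)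
  ≡⟨ cong (_+ ∑ (cube K) (𝟙 ∘ isPositiveCollision?)) (bothZeroProducts≡ K) ⟩
    zeroProducts K * zeroProducts K + ∑ (cube K) (𝟙 ∘ isPositiveCollision?)
  ≤⟨ +-mono-≤ (*-mono-≤ (zeroProducts-≤ K) (zeroProducts-≤ K))
              (≤-trans (positiveCollisions-≤-parameters K) (ParameterCount.parameters-≤ K)) ⟩
    (2 * suc K) * (2 * suc K) + 2 * (K * (K * (⌊log₂ K ⌋ + 1)))
  ∎
  where open ≤-Reasoning

-- Collisions of the form x² + 3y²

form : ℕ → ℕ → ℕ
form x y = x * x + 3 * (y * y)

IsFormCollision : Quad → Set
IsFormCollision (x , y , x' , y') = form x y ≡ form x' y'

isFormCollision? : Decidable IsFormCollision
isFormCollision? (x , y , x' , y') = form x y ≟ form x' y'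

formCollisions : ℕ → ℕ
formCollisions A = ∑ (cube A) (𝟙 ∘ isFormCollision?)

form-collision-≤ : ∀ {x y x' y'} → form x y ≡ form x' y' → x' ≤ x → y ≤ y'
form-collision-≤ {x} {y} {x'} {y'} eq x'≤x with y ≤? y'
... | yes y≤y' = y≤y'
... | no y≰y' = ⊥-elim (<-irrefl refl (begin-strict
      form x' y'                 <⟨ +-monoʳ-< (x' * x') (*-monoʳ-< 3 (*-mono-< y'<y y'<y)) ⟩
      x' * x' + 3 * (y * y)      ≤⟨ +-monoˡ-≤ (3 * (y * y)) (*-mono-≤ x'≤x x'≤x) ⟩
      form x y                   ≡⟨ eq ⟩
      form x' y'                 ∎))
  where
  open ≤-Reasoning
  y'<y = ≰⇒> y≰y'

form-collision-factors : ∀ {x y x' y'} → form x y ≡ form x' y' → x' ≤ x → y ≤ y' →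
                         (x ∸ x') * (x + x') ≡ 3 * (y' ∸ y) * (y' + y)
form-collision-factors {x} {y} {x'} {y'} eq x'≤x y≤y' = +-cancelʳ-≡ (x' * x' + 3 * (y * y)) _ _ (begin
    p * (x + x') + (x' * x' + 3 * (y * y))
  ≡⟨ cong (λ z → p * (z + x') + (x' * x' + 3 * (y * y))) x≡p+x' ⟩
    p * ((p + x') + x') + (x' * x' + 3 * (y * y))
  ≡⟨ expand-x p x' y ⟩
    form (p + x') y
  ≡⟨ cong (λ z → form z y) (sym x≡p+x') ⟩
    form x y
  ≡⟨ eq ⟩
    form x' y'
  ≡⟨ cong (form x') y'≡q+y ⟩
    x' * x' + 3 * ((q + y) * (q + y))
  ≡⟨ expand-y q y x' ⟩
    3 * q * ((q + y) + y) + (x' * x' + 3 * (y * y))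
  ≡⟨ cong (λ z → 3 * q * (z + y) + (x' * x' + 3 * (y * y))) (sym y'≡q+y) ⟩
    3 * q * (y' + y) + (x' * x' + 3 * (y * y))
  ∎)
  where
  open ≡-Reasoning
  p = x ∸ x'
  q = y' ∸ y
  x≡p+x' : x ≡ p + x'
  x≡p+x' = sym (m∸n+n≡m x'≤x)
  y'≡q+y : y' ≡ q + y
  y'≡q+y = sym (m∸n+n≡m y≤y')
  expand-x : ∀ p x' y → p * ((p + x') + x') + (x' * x' + 3 * (y * y)) ≡ (p + x') * (p + x') + 3 * (y * y)
  expand-x = solve-∀
  expand-y : ∀ q y x' → x' * x' + 3 * ((q + y) * (q + y)) ≡ 3 * q * ((q + y) + y) + (x' * x' + 3 * (y * y))
  expand-y = solve-∀

∸-+-injective : ∀ {x x' z z'} → x' ≤ x → z' ≤ z → x ∸ x' ≡ z ∸ z' → x + x' ≡ z + z' → x ≡ z × x' ≡ z'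
∸-+-injective {x} {x'} {z} {z'} x'≤x z'≤z ∸-eq +-eq = x≡z , x'≡z'
  where
  split : ∀ {x x'} → x' ≤ x → x + x' ≡ (x ∸ x') + 2 * x'
  split {x} {x'} x'≤x = begin
      x + x'                 ≡⟨ cong (_+ x') (sym (m∸n+n≡m x'≤x)) ⟩
      (x ∸ x') + x' + x'     ≡⟨ +-assoc (x ∸ x') x' x' ⟩
      (x ∸ x') + (x' + x')   ≡⟨ cong (λ w → (x ∸ x') + (x' + w)) (sym (+-identityʳ x')) ⟩
      (x ∸ x') + 2 * x'      ∎
    where open ≡-Reasoning
  x'≡z' : x' ≡ z'
  x'≡z' = *-cancelˡ-≡ x' z' 2 (+-cancelˡ-≡ (z ∸ z') _ _
            (trans (cong (_+ 2 * x') (sym ∸-eq)) (trans (sym (split x'≤x)) (trans +-eq (split z'≤z)))))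
  x≡z : x ≡ z
  x≡z = trans (sym (m∸n+n≡m x'≤x)) (trans (cong₂ _+_ ∸-eq x'≡z') (m∸n+n≡m z'≤z))

IsOrderedFormCollision : Quad → Set
IsOrderedFormCollision q@(x , y , x' , y') = IsFormCollision q × x' ≤ x

isOrderedFormCollision? : Decidable IsOrderedFormCollision
isOrderedFormCollision? q@(x , y , x' , y') = isFormCollision? q ×-dec x' ≤? x

factorMap : Quad → Quad
factorMap (x , y , x' , y') = x ∸ x' , x + x' , 3 * (y' ∸ y) , y' + y

factorMap-collision : ∀ {q} → IsOrderedFormCollision q → IsMulCollision (factorMap q)
factorMap-collision {x , y , x' , y'} (eq , x'≤x) =
  form-collision-factors {x} {y} {x'} {y'} eq x'≤x (form-collision-≤ {x} {y} {x'} {y'} eq x'≤x)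

factorMap-bounded : ∀ {A q} → Bounded A q → IsOrderedFormCollision q → Bounded (3 * A) (factorMap q)
factorMap-bounded {A} {x , y , x' , y'} (x≤A , y≤A , x'≤A , y'≤A) (eq , x'≤x) =
  ≤-trans (m∸n≤m x x') (≤-trans x≤A A≤3A) ,
  ≤-trans (+-mono-≤ x≤A x'≤A) A+A≤3A ,
  *-monoʳ-≤ 3 (≤-trans (m∸n≤m y' y) y'≤A) ,
  ≤-trans (+-mono-≤ y'≤A y≤A) A+A≤3A
  where
  A≤3A : A ≤ 3 * A
  A≤3A = m≤n*m A 3
  A+A≤3A : A + A ≤ 3 * A
  A+A≤3A = +-monoʳ-≤ A (m≤m+n A (A + 0))

factorMap-injective : ∀ {q q'} → IsOrderedFormCollision q → IsOrderedFormCollision q' → factorMap q ≡ factorMap q' → q ≡ q'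
factorMap-injective {x , y , x' , y'} {z , w , z' , w'} (eq , x'≤x) (eq' , z'≤z) same =
  cong₂ _,_ x≡z (cong₂ _,_ y≡w (cong₂ _,_ x'≡z' y'≡w'))
  where
  xs = ∸-+-injective x'≤x z'≤z (cong proj₁ same) (cong (proj₁ ∘ proj₂) same)
  x≡z = proj₁ xs
  x'≡z' = proj₂ xs
  ys = ∸-+-injective (form-collision-≤ {x} {y} {x'} {y'} eq x'≤x) (form-collision-≤ {z} {w} {z'} {w'} eq' z'≤z)
                     (*-cancelˡ-≡ _ _ 3 (cong (proj₁ ∘ proj₂ ∘ proj₂) same)) (cong (proj₂ ∘ proj₂ ∘ proj₂) same)
  y'≡w' = proj₁ ys
  y≡w = proj₂ ys

swapPairs : Quad → Quad
swapPairs (x , y , x' , y') = x' , y' , x , y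

orderedFormCollisions-≤ : ∀ A {Q : Quad → Set} (Q? : Decidable Q) (σ : Quad → Quad) →
                          (∀ {q} → Bounded A q → Bounded A (σ q)) → (∀ {q} → Q q → IsOrderedFormCollision (σ q)) →
                          (∀ {q q'} → σ q ≡ σ q' → q ≡ q') → ∑ (cube A) (𝟙 ∘ Q?) ≤ mulEnergy (3 * A)
orderedFormCollisions-≤ A {Q} Q? σ σ-bounded σ-ordered σ-injective =
  ∑𝟙-≤-injection _≟Q_ Q? isMulCollision? (factorMap ∘ σ) (cube A) (cube (3 * A)) (cube-unique A) into inj
  where
  into : ∀ {q} → q ∈ cube A → Q q → factorMap (σ q) ∈ cube (3 * A) × IsMulCollision (factorMap (σ q))
  into {q} q∈ Qq =
    ∈-cube⁺ (factorMap-bounded {A} {σ q} (σ-bounded {q} (∈-cube⁻ q∈)) (σ-ordered Qq)) , factorMap-collision {σ q} (σ-ordered Qq)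
  inj : ∀ {q q'} → q ∈ cube A → q' ∈ cube A → Q q → Q q' → factorMap (σ q) ≡ factorMap (σ q') → q ≡ q'
  inj _ _ Qq Qq' same = σ-injective (factorMap-injective (σ-ordered Qq) (σ-ordered Qq') same)

formCollisions-≤ : ∀ A → formCollisions A ≤ 2 * mulEnergy (3 * A)
formCollisions-≤ A = begin
    formCollisions A
  ≤⟨ ∑-mono (cube A) ordered-or-reversed ⟩
    ∑ (cube A) (λ q → 𝟙 (isOrderedFormCollision? q) + 𝟙 (isReversed? q))
  ≡⟨ ∑-+ (cube A) (𝟙 ∘ isOrderedFormCollision?) (𝟙 ∘ isReversed?) ⟩
    ∑ (cube A) (𝟙 ∘ isOrderedFormCollision?) + ∑ (cube A) (𝟙 ∘ isReversed?)
  ≤⟨ +-mono-≤ (orderedFormCollisions-≤ A isOrderedFormCollision? (λ q → q) (λ b → b) (λ o → o) (λ e → e))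
              (orderedFormCollisions-≤ A isReversed? swapPairs swap-bounded (λ {q} → swap-ordered {q}) swap-injective) ⟩
    mulEnergy (3 * A) + mulEnergy (3 * A)
  ≡⟨ cong (mulEnergy (3 * A) +_) (sym (+-identityʳ _)) ⟩
    2 * mulEnergy (3 * A)
  ∎
  where
  open ≤-Reasoning
  IsReversed : Quad → Set
  IsReversed q@(x , y , x' , y') = IsFormCollision q × x ≤ x'
  isReversed? : Decidable IsReversed
  isReversed? q@(x , y , x' , y') = isFormCollision? q ×-dec x ≤? x'
  ordered-or-reversed : ∀ q → 𝟙 (isFormCollision? q) ≤ 𝟙 (isOrderedFormCollision? q) + 𝟙 (isReversed? q)
  ordered-or-reversed q@(x , y , x' , y') = 𝟙≤ (isFormCollision? q) by-order
    where
    by-order : IsFormCollision q → 1 ≤ 𝟙 (isOrderedFormCollision? q) + 𝟙 (isReversed? q)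
    by-order eq with ≤-total x' x
    ... | inj₁ x'≤x = ≤-trans (≤-reflexive (sym (𝟙-yes (isOrderedFormCollision? q) (eq , x'≤x)))) (m≤m+n _ _)
    ... | inj₂ x≤x' = ≤-trans (≤-reflexive (sym (𝟙-yes (isReversed? q) (eq , x≤x')))) (m≤n+m _ _)
  swap-bounded : ∀ {q} → Bounded A q → Bounded A (swapPairs q)
  swap-bounded (x≤A , y≤A , x'≤A , y'≤A) = x'≤A , y'≤A , x≤A , y≤A
  swap-ordered : ∀ {q} → IsReversed q → IsOrderedFormCollision (swapPairs q)
  swap-ordered (eq , x≤x') = sym eq , x≤x'
  swap-injective : ∀ {q q'} → swapPairs q ≡ swapPairs q' → q ≡ q'
  swap-injective {x , y , x' , y'} {z , w , z' , w'} refl = refl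

signedRange : ℕ → List ℤ
signedRange A = map pos (range A) ++ map -[1+_] (upTo A)

∈-signedRange⁺ : ∀ {A} z → ∣ z ∣ ≤ A → z ∈ signedRange A
∈-signedRange⁺ {A} (pos n)  n≤A = ∈-++⁺ˡ (∈-map⁺ pos (∈-range⁺ n≤A))
∈-signedRange⁺ {A} -[1+ n ] n<A = ∈-++⁺ʳ (map pos (range A)) (∈-map⁺ -[1+_] (∈-upTo⁺ n<A))

∑-signedRange-≤ : ∀ A (F : ℤ → ℕ) (h : ℕ → ℕ) c → (∀ z → F z ≤ c * h ∣ z ∣) → ∑ (signedRange A) F ≤ 2 * c * ∑ (range A) h
∑-signedRange-≤ A F h c F≤ = begin
    ∑ (signedRange A) F
  ≤⟨ ∑-mono (signedRange A) F≤ ⟩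
    ∑ (signedRange A) (λ z → c * h ∣ z ∣)
  ≡⟨ ∑-++ (map pos (range A)) (map -[1+_] (upTo A)) (λ z → c * h ∣ z ∣) ⟩
    ∑ (map pos (range A)) (λ z → c * h ∣ z ∣) + ∑ (map -[1+_] (upTo A)) (λ z → c * h ∣ z ∣)
  ≡⟨ cong₂ _+_ (∑-map pos (range A) _) (trans (∑-map -[1+_] (upTo A) _) negatives) ⟩
    ∑ (range A) (λ n → c * h n) + ∑ (applyUpTo suc A) (λ n → c * h n)
  ≤⟨ +-monoʳ-≤ (∑ (range A) (λ n → c * h n)) (m≤n+m (∑ (applyUpTo suc A) (λ n → c * h n)) (c * h 0)) ⟩
    ∑ (range A) (λ n → c * h n) + ∑ (range A) (λ n → c * h n)
  ≡⟨ cong₂ _+_ (∑-*ˡ (range A) c h) (trans (∑-*ˡ (range A) c h) (sym (+-identityʳ _))) ⟩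
    c * ∑ (range A) h + (c * ∑ (range A) h + 0)
  ≡⟨ twice c (∑ (range A) h) ⟩
    2 * c * ∑ (range A) h
  ∎
  where
  open ≤-Reasoning
  twice : ∀ c s → c * s + (c * s + 0) ≡ 2 * c * s
  twice = solve-∀
  negatives : ∑ (upTo A) (λ n → c * h (suc n)) ≡ ∑ (applyUpTo suc A) (λ n → c * h n)
  negatives = trans (sym (∑-map suc (upTo A) (λ n → c * h n))) (cong (λ xs → ∑ xs (λ n → c * h n)) (map-upTo suc A))

signedSquare : ℕ → List (ℤ × ℤ)
signedSquare A = cartesianProduct (signedRange A) (signedRange A)

formAbs : ℤ × ℤ → ℕ
formAbs (X , Y) = form (∣ X ∣) (∣ Y ∣)

signedFormCollisions-≤ : ∀ A → matches _≟_ (signedSquare A) formAbs (signedSquare A) formAbs ≤ 16 * formCollisions A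
signedFormCollisions-≤ A = begin
    matches _≟_ (signedSquare A) formAbs (signedSquare A) formAbs
  ≡⟨ trans (∑-cartesianProduct S S (λ XY → ∑ (signedSquare A) (λ XY' → 𝟙 (formAbs XY ≟ formAbs XY'))))
           (∑-cong S (λ X → ∑-cong S (λ Y → ∑-cartesianProduct S S (λ XY' → 𝟙 (formAbs (X , Y) ≟ formAbs XY'))))) ⟩
    ∑ S (λ X → ∑ S λ Y → ∑ S λ X' → ∑ S λ Y' → H (∣ X ∣) (∣ Y ∣) (∣ X' ∣) (∣ Y' ∣))
  ≤⟨ ∑-signedRange-≤ A (λ X → ∑ S λ Y → ∑ S λ X' → ∑ S λ Y' → H (∣ X ∣) (∣ Y ∣) (∣ X' ∣) (∣ Y' ∣))
                       (λ x → ∑ R λ y → ∑ R λ x' → ∑ R λ y' → H x y x' y') 8 (λ X →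
     ∑-signedRange-≤ A (λ Y → ∑ S λ X' → ∑ S λ Y' → H (∣ X ∣) (∣ Y ∣) (∣ X' ∣) (∣ Y' ∣))
                       (λ y → ∑ R λ x' → ∑ R λ y' → H (∣ X ∣) y x' y') 4 (λ Y →
     ∑-signedRange-≤ A (λ X' → ∑ S λ Y' → H (∣ X ∣) (∣ Y ∣) (∣ X' ∣) (∣ Y' ∣))
                       (λ x' → ∑ R λ y' → H (∣ X ∣) (∣ Y ∣) x' y') 2 (λ X' →
     ∑-signedRange-≤ A (λ Y' → H (∣ X ∣) (∣ Y ∣) (∣ X' ∣) (∣ Y' ∣))
                       (H (∣ X ∣) (∣ Y ∣) (∣ X' ∣)) 1 (λ Y' → ≤-reflexive (sym (*-identityˡ _)))))) ⟩
    16 * ∑ R (λ x → ∑ R λ y → ∑ R λ x' → ∑ R λ y' → H x y x' y')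
  ≡⟨ cong (16 *_) (sym (∑-cube A (𝟙 ∘ isFormCollision?))) ⟩
    16 * formCollisions A
  ∎
  where
  open ≤-Reasoning
  S = signedRange A
  R = range A
  H : ℕ → ℕ → ℕ → ℕ → ℕ
  H x y x' y' = 𝟙 (form x y ≟ form x' y')

-- Triangle quadruples

module TriangleCoordinates where

  open import Data.Integer.Base using (+_; -_) renaming (_+_ to _+ᶻ_; _-_ to _-ᶻ_; _*_ to _*ᶻ_)
  open import Data.Integer.Properties using (pos-+; pos-*; m-n≡m⊖n; ⊖-≥; ⊖-<; ∣m⊝n∣≤m⊔n)
    renaming (+-injective to pos-injective; +-inverseʳ to +ᶻ-inverseʳ; +-identityʳ to +ᶻ-identityʳ)
  import Data.Integer.Tactic.RingSolver as ℤ-Solver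

  xCoord : ℕ → ℕ → ℕ → ℤ
  xCoord a b c = + 2 *ᶻ + a -ᶻ (+ b +ᶻ + c)

  yCoord : ℕ → ℕ → ℤ
  yCoord b c = + b -ᶻ + c

  +-sum³ : ∀ a b c → + (a + b + c) ≡ + a +ᶻ + b +ᶻ + c
  +-sum³ a b c = trans (pos-+ (a + b) c) (cong (_+ᶻ + c) (pos-+ a b))

  +-square : ∀ m → + (m ^ 2) ≡ + m *ᶻ + m
  +-square m = trans (cong (λ k → + (m * k)) (*-identityʳ m)) (pos-* m m)

  i*i≡+∣i∣*∣i∣ : ∀ i → i *ᶻ i ≡ + (∣ i ∣ * ∣ i ∣)
  i*i≡+∣i∣*∣i∣ (+ n)    = sym (pos-* n n)
  i*i≡+∣i∣*∣i∣ -[1+ n ] = refl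

  triangle-in-ℤ : ∀ {a b c d} → IsTriangleQuadruple (a , b , c , d) →
    (+ a +ᶻ + b +ᶻ + c +ᶻ + d) *ᶻ (+ a +ᶻ + b +ᶻ + c +ᶻ + d) ≡ + 3 *ᶻ (+ a *ᶻ + a +ᶻ + b *ᶻ + b +ᶻ + c *ᶻ + c +ᶻ + d *ᶻ + d)
  triangle-in-ℤ {a} {b} {c} {d} triangle = begin
      (+ a +ᶻ + b +ᶻ + c +ᶻ + d) *ᶻ (+ a +ᶻ + b +ᶻ + c +ᶻ + d)
    ≡⟨ sym (trans (+-square (a + b + c + d)) (cong₂ _*ᶻ_ sum sum)) ⟩
      + ((a + b + c + d) ^ 2)
    ≡⟨ cong +_ (sym triangle) ⟩
      + (3 * (a ^ 2 + b ^ 2 + c ^ 2 + d ^ 2))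
    ≡⟨ trans (pos-* 3 (a ^ 2 + b ^ 2 + c ^ 2 + d ^ 2)) (cong (+ 3 *ᶻ_) squares) ⟩
      + 3 *ᶻ (+ a *ᶻ + a +ᶻ + b *ᶻ + b +ᶻ + c *ᶻ + c +ᶻ + d *ᶻ + d)
    ∎
    where
    open ≡-Reasoning
    sum : + (a + b + c + d) ≡ + a +ᶻ + b +ᶻ + c +ᶻ + d
    sum = trans (pos-+ (a + b + c) d) (cong (_+ᶻ + d) (+-sum³ a b c))
    squares : + (a ^ 2 + b ^ 2 + c ^ 2 + d ^ 2) ≡ + a *ᶻ + a +ᶻ + b *ᶻ + b +ᶻ + c *ᶻ + c +ᶻ + d *ᶻ + d
    squares = trans (pos-+ (a ^ 2 + b ^ 2 + c ^ 2) (d ^ 2)) (cong₂ _+ᶻ_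
                (trans (pos-+ (a ^ 2 + b ^ 2) (c ^ 2)) (cong₂ _+ᶻ_
                  (trans (pos-+ (a ^ 2) (b ^ 2)) (cong₂ _+ᶻ_ (+-square a) (+-square b))) (+-square c)))
                (+-square d))

  polynomial-identity : ∀ a b c d →
    + 4 *ᶻ (d *ᶻ (a +ᶻ b +ᶻ c -ᶻ d)) ≡
    (+ 2 *ᶻ a -ᶻ (b +ᶻ c)) *ᶻ (+ 2 *ᶻ a -ᶻ (b +ᶻ c)) +ᶻ + 3 *ᶻ ((b -ᶻ c) *ᶻ (b -ᶻ c))
      +ᶻ + 2 *ᶻ ((a +ᶻ b +ᶻ c +ᶻ d) *ᶻ (a +ᶻ b +ᶻ c +ᶻ d) -ᶻ + 3 *ᶻ (a *ᶻ a +ᶻ b *ᶻ b +ᶻ c *ᶻ c +ᶻ d *ᶻ d))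
  polynomial-identity = ℤ-Solver.solve-∀

  four-d[s-d] : ∀ {a b c d} → IsTriangleQuadruple (a , b , c , d) →
    + 4 *ᶻ (+ d *ᶻ (+ a +ᶻ + b +ᶻ + c -ᶻ + d)) ≡ + (∣ xCoord a b c ∣ * ∣ xCoord a b c ∣ + 3 * (∣ yCoord b c ∣ * ∣ yCoord b c ∣))
  four-d[s-d] {a} {b} {c} {d} triangle = begin
      + 4 *ᶻ (+ d *ᶻ (+ a +ᶻ + b +ᶻ + c -ᶻ + d))
    ≡⟨ polynomial-identity (+ a) (+ b) (+ c) (+ d) ⟩
      X *ᶻ X +ᶻ + 3 *ᶻ (Y *ᶻ Y) +ᶻ + 2 *ᶻ (S *ᶻ S -ᶻ + 3 *ᶻ Σ)
    ≡⟨ cong (λ z → X *ᶻ X +ᶻ + 3 *ᶻ (Y *ᶻ Y) +ᶻ + 2 *ᶻ (z -ᶻ + 3 *ᶻ Σ)) (triangle-in-ℤ {a} {b} {c} {d} triangle) ⟩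
      X *ᶻ X +ᶻ + 3 *ᶻ (Y *ᶻ Y) +ᶻ + 2 *ᶻ (+ 3 *ᶻ Σ -ᶻ + 3 *ᶻ Σ)
    ≡⟨ cong (λ z → X *ᶻ X +ᶻ + 3 *ᶻ (Y *ᶻ Y) +ᶻ + 2 *ᶻ z) (+ᶻ-inverseʳ (+ 3 *ᶻ Σ)) ⟩
      X *ᶻ X +ᶻ + 3 *ᶻ (Y *ᶻ Y) +ᶻ + 0
    ≡⟨ +ᶻ-identityʳ _ ⟩
      X *ᶻ X +ᶻ + 3 *ᶻ (Y *ᶻ Y)
    ≡⟨ cong₂ (λ u v → u +ᶻ + 3 *ᶻ v) (i*i≡+∣i∣*∣i∣ X) (i*i≡+∣i∣*∣i∣ Y) ⟩
      + (∣ X ∣ * ∣ X ∣) +ᶻ + 3 *ᶻ + (∣ Y ∣ * ∣ Y ∣)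
    ≡⟨ sym (trans (pos-+ (∣ X ∣ * ∣ X ∣) _) (cong (+ (∣ X ∣ * ∣ X ∣) +ᶻ_) (pos-* 3 (∣ Y ∣ * ∣ Y ∣)))) ⟩
      + (∣ X ∣ * ∣ X ∣ + 3 * (∣ Y ∣ * ∣ Y ∣))
    ∎
    where
    open ≡-Reasoning
    X = xCoord a b c
    Y = yCoord b c
    S = + a +ᶻ + b +ᶻ + c +ᶻ + d
    Σ = + a *ᶻ + a +ᶻ + b *ᶻ + b +ᶻ + c *ᶻ + c +ᶻ + d *ᶻ + d

  -+≢+ : ∀ {m n} → 1 ≤ m → - (+ m) ≢ + n
  -+≢+ {suc m} _ ()

  s-ᶻd≡s⊖d : ∀ a b c d → + a +ᶻ + b +ᶻ + c -ᶻ + d ≡ (a + b + c) ⊖ d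
  s-ᶻd≡s⊖d a b c d = trans (cong (_-ᶻ + d) (sym (+-sum³ a b c))) (m-n≡m⊖n (a + b + c) d)

  triangle-facts : ∀ {a b c d} → IsTriangleQuadruple (a , b , c , d) →
    d ≤ a + b + c × 4 * (d * (a + b + c ∸ d)) ≡ ∣ xCoord a b c ∣ * ∣ xCoord a b c ∣ + 3 * (∣ yCoord b c ∣ * ∣ yCoord b c ∣)
  triangle-facts {a} {b} {c} {d} triangle with d ≤? a + b + c
  ... | yes d≤s = d≤s , pos-injective (begin
        + (4 * (d * (a + b + c ∸ d)))
      ≡⟨ trans (pos-* 4 (d * (a + b + c ∸ d))) (cong (+ 4 *ᶻ_) (pos-* d (a + b + c ∸ d))) ⟩
        + 4 *ᶻ (+ d *ᶻ + (a + b + c ∸ d))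
      ≡⟨ cong (λ z → + 4 *ᶻ (+ d *ᶻ z)) (sym (trans (s-ᶻd≡s⊖d a b c d) (⊖-≥ d≤s))) ⟩
        + 4 *ᶻ (+ d *ᶻ (+ a +ᶻ + b +ᶻ + c -ᶻ + d))
      ≡⟨ four-d[s-d] {a} {b} {c} {d} triangle ⟩
        + (∣ xCoord a b c ∣ * ∣ xCoord a b c ∣ + 3 * (∣ yCoord b c ∣ * ∣ yCoord b c ∣))
      ∎)
    where open ≡-Reasoning
  ... | no d≰s = ⊥-elim (-+≢+ 1≤4dk (trans (sym negative) (four-d[s-d] {a} {b} {c} {d} triangle)))
    where
    open ≡-Reasoning
    s<d = ≰⇒> d≰s
    k = d ∸ (a + b + c)
    1≤4dk : 1 ≤ 4 * (d * k)
    1≤4dk = *-mono-≤ {1} {4} (s≤s z≤n) (*-mono-≤ (≤-trans (s≤s z≤n) s<d) (m<n⇒0<n∸m s<d))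
    x[y[-z]]≡-[x[yz]] : ∀ x y z → x *ᶻ (y *ᶻ (- z)) ≡ - (x *ᶻ (y *ᶻ z))
    x[y[-z]]≡-[x[yz]] = ℤ-Solver.solve-∀
    negative : + 4 *ᶻ (+ d *ᶻ (+ a +ᶻ + b +ᶻ + c -ᶻ + d)) ≡ - (+ (4 * (d * k)))
    negative = begin
        + 4 *ᶻ (+ d *ᶻ (+ a +ᶻ + b +ᶻ + c -ᶻ + d))
      ≡⟨ cong (λ z → + 4 *ᶻ (+ d *ᶻ z)) (trans (s-ᶻd≡s⊖d a b c d) (⊖-< s<d)) ⟩
        + 4 *ᶻ (+ d *ᶻ (- (+ k)))
      ≡⟨ x[y[-z]]≡-[x[yz]] (+ 4) (+ d) (+ k) ⟩
        - (+ 4 *ᶻ (+ d *ᶻ + k))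
      ≡⟨ cong -_ (sym (trans (pos-* 4 (d * k)) (cong (+ 4 *ᶻ_) (pos-* d k)))) ⟩
        - (+ (4 * (d * k)))
      ∎

  3a≡x+s : ∀ a b c → + (3 * a) ≡ xCoord a b c +ᶻ + (a + b + c)
  3a≡x+s a b c = trans (pos-* 3 a) (trans (identity (+ a) (+ b) (+ c)) (cong (xCoord a b c +ᶻ_) (sym (+-sum³ a b c))))
    where
    identity : ∀ a b c → + 3 *ᶻ a ≡ (+ 2 *ᶻ a -ᶻ (b +ᶻ c)) +ᶻ (a +ᶻ b +ᶻ c)
    identity = ℤ-Solver.solve-∀

  2b≡y+[b+c] : ∀ b c → + (2 * b) ≡ yCoord b c +ᶻ + (b + c)
  2b≡y+[b+c] b c = trans (pos-* 2 b) (trans (identity (+ b) (+ c)) (cong (yCoord b c +ᶻ_) (sym (pos-+ b c))))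
    where
    identity : ∀ b c → + 2 *ᶻ b ≡ (b -ᶻ c) +ᶻ (b +ᶻ c)
    identity = ℤ-Solver.solve-∀

  coordinates-injective : ∀ {a b c a' b' c'} → a + b + c ≡ a' + b' + c' →
    xCoord a b c ≡ xCoord a' b' c' → yCoord b c ≡ yCoord b' c' → a ≡ a' × b ≡ b' × c ≡ c'
  coordinates-injective {a} {b} {c} {a'} {b'} {c'} s≡s' x≡x' y≡y' = a≡a' , b≡b' , c≡c'
    where
    a≡a' : a ≡ a'
    a≡a' = *-cancelˡ-≡ a a' 3 (pos-injective
             (trans (3a≡x+s a b c) (trans (cong₂ (λ x s → x +ᶻ + s) x≡x' s≡s') (sym (3a≡x+s a' b' c')))))
    b+c≡b'+c' : b + c ≡ b' + c'
    b+c≡b'+c' = +-cancelˡ-≡ a (b + c) (b' + c')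
                  (trans (sym (+-assoc a b c)) (trans s≡s' (trans (cong (λ z → z + b' + c') (sym a≡a')) (+-assoc a b' c'))))
    b≡b' : b ≡ b'
    b≡b' = *-cancelˡ-≡ b b' 2 (pos-injective
             (trans (2b≡y+[b+c] b c) (trans (cong₂ (λ y s → y +ᶻ + s) y≡y' b+c≡b'+c') (sym (2b≡y+[b+c] b' c')))))
    c≡c' : c ≡ c'
    c≡c' = +-cancelˡ-≡ b c c' (trans b+c≡b'+c' (cong (_+ c') (sym b≡b')))

  ∣xCoord∣≤ : ∀ {a b c n} → a ≤ n → b ≤ n → c ≤ n → ∣ xCoord a b c ∣ ≤ 2 * n
  ∣xCoord∣≤ {a} {b} {c} {n} a≤n b≤n c≤n = begin
      ∣ xCoord a b c ∣
    ≡⟨ cong ∣_∣ (trans (cong₂ _-ᶻ_ (sym (pos-* 2 a)) (sym (pos-+ b c))) (m-n≡m⊖n (2 * a) (b + c))) ⟩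
      ∣ (2 * a) ⊖ (b + c) ∣
    ≤⟨ ∣m⊝n∣≤m⊔n (2 * a) (b + c) ⟩
      2 * a ⊔ (b + c)
    ≤⟨ ⊔-lub (*-monoʳ-≤ 2 a≤n) (≤-trans (+-mono-≤ b≤n c≤n) (≤-reflexive (cong (λ m → n + m) (sym (+-identityʳ n))))) ⟩
      2 * n
    ∎
    where open ≤-Reasoning

  ∣yCoord∣≤ : ∀ {b c n} → b ≤ n → c ≤ n → ∣ yCoord b c ∣ ≤ n
  ∣yCoord∣≤ {b} {c} b≤n c≤n =
    ≤-trans (≤-reflexive (cong ∣_∣ (m-n≡m⊖n b c))) (≤-trans (∣m⊝n∣≤m⊔n b c) (⊔-lub b≤n c≤n))

open TriangleCoordinates using (xCoord; yCoord; triangle-facts; coordinates-injective; ∣xCoord∣≤; ∣yCoord∣≤)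

scaledProduct : ℕ × ℕ → ℕ
scaledProduct (d , u) = 4 * (d * u)

scaledProductMatches-≤ : ∀ K → matches _≟_ (square K) scaledProduct (square K) scaledProduct ≤ mulEnergy K
scaledProductMatches-≤ K = begin
    matches _≟_ (square K) scaledProduct (square K) scaledProduct
  ≡⟨ trans (∑-square K (λ p → ∑ (square K) (λ p' → 𝟙 (scaledProduct p ≟ scaledProduct p'))))
           (∑-cong R λ d → ∑-cong R λ u → ∑-square K (λ p' → 𝟙 (scaledProduct (d , u) ≟ scaledProduct p'))) ⟩
    ∑ R (λ d → ∑ R λ u → ∑ R λ d' → ∑ R λ u' → 𝟙 (4 * (d * u) ≟ 4 * (d' * u')))
  ≤⟨ ∑-mono R (λ d → ∑-mono R λ u → ∑-mono R λ d' → ∑-mono R λ u' →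
       𝟙-mono (4 * (d * u) ≟ 4 * (d' * u')) (d * u ≟ d' * u') (*-cancelˡ-≡ (d * u) (d' * u') 4)) ⟩
    ∑ R (λ d → ∑ R λ u → ∑ R λ d' → ∑ R λ u' → 𝟙 (d * u ≟ d' * u'))
  ≡⟨ sym (∑-cube K (𝟙 ∘ isMulCollision?)) ⟩
    mulEnergy K
  ∎
  where
  open ≤-Reasoning
  R = range K

triangleCoordinates : Quad → (ℕ × ℕ) × (ℤ × ℤ)
triangleCoordinates (a , b , c , d) = (d , a + b + c ∸ d) , (xCoord a b c , yCoord b c)

IsCoordinateMatch : (ℕ × ℕ) × (ℤ × ℤ) → Set
IsCoordinateMatch (p , XY) = scaledProduct p ≡ formAbs XY

triangleCoordinates-∈ : ∀ {n q} → Bounded n q → IsTriangleQuadruple q →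
                        triangleCoordinates q ∈ cartesianProduct (square (6 * n)) (signedSquare (2 * n)) ×
                        IsCoordinateMatch (triangleCoordinates q)
triangleCoordinates-∈ {n} {a , b , c , d} (a≤n , b≤n , c≤n , d≤n) triangle =
  ∈-cartesianProduct⁺ (∈-square⁺ (≤-trans d≤n (m≤n*m n 6)) (≤-trans (m∸n≤m (a + b + c) d) s≤6n))
                      (∈-cartesianProduct⁺ (∈-signedRange⁺ (xCoord a b c) (∣xCoord∣≤ a≤n b≤n c≤n))
                                           (∈-signedRange⁺ (yCoord b c) (≤-trans (∣yCoord∣≤ b≤n c≤n) (m≤n*m n 2)))) ,
  proj₂ (triangle-facts {a} {b} {c} {d} triangle)
  where
  k+k+k≡3*k : ∀ k → k + k + k ≡ 3 * k
  k+k+k≡3*k = solve-∀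
  s≤6n : a + b + c ≤ 6 * n
  s≤6n = ≤-trans (+-mono-≤ (+-mono-≤ a≤n b≤n) c≤n) (≤-trans (≤-reflexive (k+k+k≡3*k n)) (*-monoˡ-≤ n (m≤m+n 3 3)))

triangleCoordinates-injective : ∀ {q q'} → IsTriangleQuadruple q → IsTriangleQuadruple q' →
                                triangleCoordinates q ≡ triangleCoordinates q' → q ≡ q'
triangleCoordinates-injective {a , b , c , d} {a' , b' , c' , d'} triangle triangle' same =
  cong₂ _,_ (proj₁ abc) (cong₂ _,_ (proj₁ (proj₂ abc)) (cong₂ _,_ (proj₂ (proj₂ abc)) d≡d'))
  where
  d≡d' : d ≡ d'
  d≡d' = cong (proj₁ ∘ proj₁) same
  s≡s' : a + b + c ≡ a' + b' + c'
  s≡s' = trans (sym (m∸n+n≡m (proj₁ (triangle-facts {a} {b} {c} {d} triangle))))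
               (trans (cong₂ _+_ (cong (proj₂ ∘ proj₁) same) d≡d') (m∸n+n≡m (proj₁ (triangle-facts {a'} {b'} {c'} {d'} triangle'))))
  abc = coordinates-injective {a} {b} {c} {a'} {b'} {c'} s≡s' (cong (proj₁ ∘ proj₂) same) (cong (proj₂ ∘ proj₂) same)

triangleQuadruples-≤ : ∀ n → ∑ (cube n) (𝟙 ∘ isTriangleQuadruple?) ≤
                       matches _≟_ (square (6 * n)) scaledProduct (signedSquare (2 * n)) formAbs
triangleQuadruples-≤ n = begin
    ∑ (cube n) (𝟙 ∘ isTriangleQuadruple?)
  ≤⟨ ∑𝟙-≤-injection _≟C_ isTriangleQuadruple? (λ (p , XY) → scaledProduct p ≟ formAbs XY) triangleCoordinates
                      (cube n) (cartesianProduct (square (6 * n)) (signedSquare (2 * n))) (cube-unique n)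
                      (λ {q} q∈ → triangleCoordinates-∈ {n} {q} (∈-cube⁻ q∈))
                      (λ _ _ → triangleCoordinates-injective) ⟩
    ∑ (cartesianProduct (square (6 * n)) (signedSquare (2 * n))) (λ (p , XY) → 𝟙 (scaledProduct p ≟ formAbs XY))
  ≡⟨ ∑-cartesianProduct (square (6 * n)) (signedSquare (2 * n)) (λ (p , XY) → 𝟙 (scaledProduct p ≟ formAbs XY)) ⟩
    matches _≟_ (square (6 * n)) scaledProduct (signedSquare (2 * n)) formAbs
  ∎
  where
  open ≤-Reasoning
  _≟C_ : DecidableEquality ((ℕ × ℕ) × (ℤ × ℤ))
  _≟C_ = ≡-dec (≡-dec _≟_ _≟_) (≡-dec _≟ℤ_ _≟ℤ_)

F-≤ : ∀ n → F n ≤ 33 * mulEnergy (6 * n)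
F-≤ n = begin
    F n
  ≡⟨ length-filter isCounted? (quadsUpTo n) ⟩
    ∑ (quadsUpTo n) (𝟙 ∘ isCounted?)
  ≤⟨ ∑-mono (quadsUpTo n) (λ q → 𝟙-mono (isCounted? q) (isTriangleQuadruple? q) proj₁) ⟩
    ∑ (quadsUpTo n) (𝟙 ∘ isTriangleQuadruple?)
  ≡⟨ ∑-quadsUpTo n (𝟙 ∘ isTriangleQuadruple?) ⟩
    ∑ (cube n) (𝟙 ∘ isTriangleQuadruple?)
  ≤⟨ triangleQuadruples-≤ n ⟩
    matches _≟_ (square K) scaledProduct (signedSquare A) formAbs
  ≤⟨ matches-≤ _≟_ (square K) scaledProduct (signedSquare A) formAbs ⟩
    matches _≟_ (square K) scaledProduct (square K) scaledProduct + matches _≟_ (signedSquare A) formAbs (signedSquare A) formAbs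
  ≤⟨ +-mono-≤ (scaledProductMatches-≤ K) (≤-trans (signedFormCollisions-≤ A) (*-monoʳ-≤ 16 (formCollisions-≤ A))) ⟩
    mulEnergy K + 16 * (2 * mulEnergy (3 * A))
  ≡⟨ cong (λ m → mulEnergy K + 16 * (2 * mulEnergy m)) (sym (*-assoc 3 2 n)) ⟩
    mulEnergy K + 16 * (2 * mulEnergy K)
  ≡⟨ m+16[2m]≡33m (mulEnergy K) ⟩
    33 * mulEnergy K
  ∎
  where
  open ≤-Reasoning
  K = 6 * n
  A = 2 * n
  isCounted? : Decidable (λ q → IsTriangleQuadruple q × sumSq q ≤ n ^ 2)
  isCounted? q = isTriangleQuadruple? q ×-dec (sumSq q ≤? n ^ 2)
  m+16[2m]≡33m : ∀ m → m + 16 * (2 * m) ≡ 33 * m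
  m+16[2m]≡33m = solve-∀

mulEnergy-6n-≤ : ∀ n → 2 ≤ n → mulEnergy (6 * n) ≤ 556 * (n * n * ⌊log₂ n ⌋)
mulEnergy-6n-≤ n@(suc _) 2≤n = begin
    mulEnergy (6 * n)
  ≤⟨ mulEnergy-≤ (6 * n) ⟩
    2 * suc (6 * n) * (2 * suc (6 * n)) + 2 * (6 * n * (6 * n * (⌊log₂ (6 * n) ⌋ + 1)))
  ≤⟨ +-mono-≤ (*-mono-≤ 2[1+6n]≤14n 2[1+6n]≤14n) (*-monoʳ-≤ 2 (*-monoʳ-≤ (6 * n) (*-monoʳ-≤ (6 * n) (⌊log₂6n⌋+1≤5⌊log₂n⌋ 2≤n)))) ⟩
    14 * n * (14 * n) + 2 * (6 * n * (6 * n * (5 * L)))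
  ≤⟨ +-monoˡ-≤ _ (≤-trans (≤-reflexive (square-14n n)) (*-monoʳ-≤ 196 (m≤m*n (n * n) L {{>-nonZero 1≤L}}))) ⟩
    196 * (n * n * L) + 2 * (6 * n * (6 * n * (5 * L)))
  ≡⟨ collect n L ⟩
    556 * (n * n * L)
  ∎
  where
  open ≤-Reasoning
  L = ⌊log₂ n ⌋
  1≤L : 1 ≤ L
  1≤L = 2≤n⇒1≤⌊log₂n⌋ 2≤n
  2[1+6n]≤14n : 2 * suc (6 * n) ≤ 14 * n
  2[1+6n]≤14n = ≤-trans (≤-reflexive (expand n)) (≤-trans (+-monoˡ-≤ (12 * n) (*-monoʳ-≤ 2 (s≤s z≤n))) (≤-reflexive (add n)))
    where
    expand : ∀ k → 2 * suc (6 * k) ≡ 2 * 1 + 12 * k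
    expand = solve-∀
    add : ∀ k → 2 * k + 12 * k ≡ 14 * k
    add = solve-∀
  square-14n : ∀ k → 14 * k * (14 * k) ≡ 196 * (k * k)
  square-14n = solve-∀
  collect : ∀ k l → 196 * (k * k * l) + 2 * (6 * k * (6 * k * (5 * l))) ≡ 556 * (k * k * l)
  collect = solve-∀

theorem2 : ∃₂ λ (C N : ℕ) → ∀ (n : ℕ) → N ≤ n → F n ≤ C * n ^ 2 * ⌊log₂ n ⌋ ^ 3
theorem2 = 18348 , 2 , λ n 2≤n → let L = ⌊log₂ n ⌋ in begin
    F n                                     ≤⟨ F-≤ n ⟩
    33 * mulEnergy (6 * n)                  ≤⟨ *-monoʳ-≤ 33 (mulEnergy-6n-≤ n 2≤n) ⟩
    33 * (556 * (n * n * L))                ≤⟨ *-monoʳ-≤ 33 (*-monoʳ-≤ 556 (*-monoʳ-≤ (n * n) (L≤L³ (2≤n⇒1≤⌊log₂n⌋ 2≤n)))) ⟩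
    33 * (556 * (n * n * (L * (L * L))))    ≡⟨ normalise n L ⟩
    18348 * n ^ 2 * L ^ 3                   ∎
  where
  open ≤-Reasoning
  L≤L³ : ∀ {L} → 1 ≤ L → L ≤ L * (L * L)
  L≤L³ {L} 1≤L = m≤m*n L (L * L) {{>-nonZero (*-mono-≤ 1≤L 1≤L)}}
  -- Stated with k ^ 2 and l ^ 3 unfolded, since the solver does not accept _^_ here.
  normalise : ∀ k l → 33 * (556 * (k * k * (l * (l * l)))) ≡ 18348 * (k * (k * 1)) * (l * (l * (l * 1)))
  normalise = solve-∀
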